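{- Let $\gamma>0$ and let $n\in\mathbb N$ be even with $1/n\ll\gamma$. Suppose that $G$ is a graph on $n$ vertices with $\delta(G)\ge (1/2-\gamma)n$. Then at least one of the following holds: $G$ contains a $3\gamma$-independent set of size at least $n/2$; $G$ is $3\gamma$-close to $2K_{n/2}$; $G$ contains a perfect matching.
   Context: $1/n\ll\gamma$ means $n$ is sufficiently large in terms of $\gamma$. For a graph $G$ on $n$ vertices, $S\subseteq V(G)$ is $\beta$-independent if $G[S]$ has at most $\beta n^2$ edges. $G$ is $\beta$-close to $2K_{n/2}$ if there is a partition $A,B$ of $V(G)$ with $|A|=\lfloor n/2\rfloor$, $|B|=\lceil n/2\rceil$ and at most $\beta n^2$ edges with one endpoint in $A$ and the other in $B$. A perfect matching is a set of vertex-disjoint edges covering all vertices.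
   Formalization: The parameter γ ranges over the positive rationals. -}

module Defs where

open import Data.Bool using (Bool; true; false; if_then_else_; _∧_; not)
open import Data.Nat using (ℕ; zero; suc; _+_; _<ᵇ_)
open import Data.Fin using (Fin; toℕ)
import Data.Fin as Fin
open import Data.Fin.Subset using (Subset; ∣_∣)
open import Data.Vec using (lookup)
open import Data.Integer using (+_)
open import Data.Rational using (ℚ; _/_; _≤_; _*_; _-_; ½)
open import Data.Product using (Σ; _×_; ∃)
open import Relation.Binary.PropositionalEquality using (_≡_)

record Graph (n : ℕ) : Set where
  field
    adj   : Fin n → Fin n → Bool
    sym   : ∀ u v → adj u v ≡ adj v u
    irrefl : ∀ v → adj v v ≡ false
open Graph public

countF : ∀ {n} → (Fin n → Bool) → ℕ
countF {zero}  f = 0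
countF {suc n} f = (if f Fin.zero then 1 else 0) + countF (λ i → f (Fin.suc i))

sumF : ∀ {n} → (Fin n → ℕ) → ℕ
sumF {zero}  f = 0
sumF {suc n} f = f Fin.zero + sumF (λ i → f (Fin.suc i))

countPairs : ∀ {n} → (Fin n → Fin n → Bool) → ℕ
countPairs f = sumF (λ u → countF (f u))

ℕ→ℚ : ℕ → ℚ
ℕ→ℚ m = + m / 1

degree : ∀ {n} → Graph n → Fin n → ℕ
degree G v = countF (adj G v)

MinDegreeAtLeast : ∀ {n} → Graph n → ℚ → Set
MinDegreeAtLeast {n} G x = ∀ v → x ≤ ℕ→ℚ (degree G v)

-- number of edges of G[S] (unordered pairs {u,v}, counted once via u < v)
edgesIn : ∀ {n} → Graph n → Subset n → ℕ
edgesIn G S = countPairs (λ u v →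
  lookup S u ∧ lookup S v ∧ adj G u v ∧ (toℕ u <ᵇ toℕ v))

crossEdges : ∀ {n} → Graph n → Subset n → ℕ
crossEdges G A = countPairs (λ u v →
  lookup A u ∧ not (lookup A v) ∧ adj G u v)

Independent : ∀ {n} → Graph n → ℚ → Subset n → Set
Independent {n} G β S = ℕ→ℚ (edgesIn G S) ≤ β * ℕ→ℚ (n Data.Nat.* n)

-- G is β-close to 2K_{n/2}: a partition A, B = complement of A, with
-- |A| = ⌊n/2⌋ (so |B| = ⌈n/2⌉) and at most β n² edges between A and B
CloseTo2K : ∀ {n} → Graph n → ℚ → Set
CloseTo2K {n} G β = Σ (Subset n) λ A →
  (∣ A ∣ ≡ n Data.Nat./ 2) × (ℕ→ℚ (crossEdges G A) ≤ β * ℕ→ℚ (n Data.Nat.* n))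

-- perfect matching: a fixed-point-free involution m with every pair {v, m v}
-- an edge; the edges {v, m v} are then vertex-disjoint and cover V(G)
PerfectMatching : ∀ {n} → Graph n → Set
PerfectMatching {n} G = Σ (Fin n → Fin n) λ m →
  (∀ v → m (m v) ≡ v) × (∀ v → adj G v (m v) ≡ true)

module Submission where

-- Let d be the largest
-- deficiency n ∸ 2 deg(x), so d ≤ 2γn.  Augmenting from the empty matching
-- gives a perfect matching or a matching M with no augmenting path of length
-- 1, 3 or 5 and (n being even) two unmatched vertices u, v.  Classifying each
-- matching edge xx' by which of u, v its ends see, the missing short paths
-- rule out most configurations, and double counting deg u + deg v shows that
-- the irregular edges R and unmatched vertices U satisfy |R| + 2|U| ≤ 2d.
-- If some partner x' sees both u and v, the vertices whose partner sees both
-- form with U an independent set that extends to n/2 sparse vertices;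
-- otherwise edges seeing u twice (P) and v twice (Q) have no edges between
-- them, and a half inside P, inside Q, or P completed from R ∪ U is a sparse
-- cut.  Every bound reads 4e ≤ 5nd ≤ 10γn², i.e. e ≤ 3γn².
module _ where

  open import Defs hiding (sym)
  open import Data.Bool using (Bool; true; false; if_then_else_; not; _∧_; _∨_; T)
  import Data.Bool as Bool
  open import Data.Bool.Properties
    using (T-∧; ¬-not; ∧-inverseʳ; ∨-zeroʳ; ∧-zeroʳ; ∧-comm) renaming (∧-identityʳ to ∧-true)
  open import Data.Empty using (⊥; ⊥-elim)
  open import Data.Fin using (Fin; zero; suc; _≟_; toℕ)
  import Data.Fin.Permutation as Permutation
  open import Data.Fin.Properties using (any?; toℕ-injective)
  open import Data.Fin.Subset using (Subset; ∣_∣)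
  open import Data.Nat hiding (_≟_)
  open import Data.Nat.DivMod using (m*n/n≡m)
  open import Data.Nat.Divisibility using (_∣_; divides)
  open import Data.Nat.Properties hiding (_≟_)
  open import Algebra.Properties.CommutativeMonoid.Sum +-0-commutativeMonoid using (sum; sum-permute)
  open import Algebra.Properties.CommutativeSemigroup +-commutativeSemigroup using (interchange)
  open import Data.Nat.Tactic.RingSolver using (solve-∀)
  open import Data.Product using (Σ; _×_; _,_; proj₁; proj₂)
  open import Data.Rational as ℚ using (ℚ; 0ℚ; ½)
    renaming (_<_ to _<ℚ_; _≤_ to _≤ℚ_; _*_ to _*ℚ_; _-_ to _-ℚ_)
  open import Data.Sum using (_⊎_; inj₁; inj₂)
  open import Data.Vec using (tabulate)
  open import Data.Vec.Properties using (lookup∘tabulate)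
  open import Function using (_∘_; case_of_)
  open import Function.Bundles using (Equivalence)
  open import Relation.Binary.PropositionalEquality
  open import Relation.Nullary using (Dec; yes; no; does; ¬?; _×-dec_)
  open import Relation.Nullary.Decidable using (dec-true; dec-false)

  VSet : ℕ → Set
  VSet n = Fin n → Bool

  _⊆_ : ∀ {n} → VSet n → VSet n → Set
  A ⊆ B = ∀ i → A i ≡ true → B i ≡ true

  Disjoint : ∀ {n} → VSet n → VSet n → Set
  Disjoint A B = ∀ i → (A i ∧ B i) ≡ false

  ∁ : ∀ {n} → VSet n → VSet n
  ∁ A i = not (A i)

  _∪_ : ∀ {n} → VSet n → VSet n → VSet n
  (A ∪ B) i = A i ∨ B i

  _∩_ : ∀ {n} → VSet n → VSet n → VSet n
  (A ∩ B) i = A i ∧ B i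

  ⟦_⟧ : Bool → ℕ
  ⟦ b ⟧ = if b then 1 else 0

  count-as-sum : ∀ {n} (A : VSet n) → countF A ≡ sumF (λ i → ⟦ A i ⟧)
  count-as-sum {zero}  A = refl
  count-as-sum {suc n} A = cong (⟦ A zero ⟧ +_) (count-as-sum (A ∘ suc))

  sum-cong : ∀ {n} {f g : Fin n → ℕ} → (∀ i → f i ≡ g i) → sumF f ≡ sumF g
  sum-cong {zero}  e = refl
  sum-cong {suc n} e = cong₂ _+_ (e zero) (sum-cong (e ∘ suc))

  sum-mono : ∀ {n} {f g : Fin n → ℕ} → (∀ i → f i ≤ g i) → sumF f ≤ sumF g
  sum-mono {zero}  e = z≤n
  sum-mono {suc n} e = +-mono-≤ (e zero) (sum-mono (e ∘ suc))

  sum-+ : ∀ {n} (f g : Fin n → ℕ) → sumF (λ i → f i + g i) ≡ sumF f + sumF g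
  sum-+ {zero}  f g = refl
  sum-+ {suc n} f g = trans (cong (f zero + g zero +_) (sum-+ (f ∘ suc) (g ∘ suc)))
                            (interchange (f zero) (g zero) _ _)

  sum-*ˡ : ∀ {n} (c : ℕ) (f : Fin n → ℕ) → sumF (λ i → c * f i) ≡ c * sumF f
  sum-*ˡ {zero}  c f = sym (*-zeroʳ c)
  sum-*ˡ {suc n} c f = trans (cong (c * f zero +_) (sum-*ˡ c (f ∘ suc)))
                             (sym (*-distribˡ-+ c (f zero) _))

  sum-const : ∀ {n} (c : ℕ) → sumF {n} (λ _ → c) ≡ n * c
  sum-const {zero}  c = refl
  sum-const {suc n} c = cong (c +_) (sum-const {n} c)

  sum-swap : ∀ {m n} (g : Fin m → Fin n → ℕ) →
    sumF (λ i → sumF (g i)) ≡ sumF (λ j → sumF (λ i → g i j))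
  sum-swap {zero}  {n} g = sym (trans (sum-const {n} 0) (*-zeroʳ n))
  sum-swap {suc m} {n} g = trans (cong (sumF (g zero) +_) (sum-swap (g ∘ suc)))
                                 (sym (sum-+ (g zero) (λ j → sumF (λ i → g (suc i) j))))

  sum-involution : ∀ {n} (m : Fin n → Fin n) → (∀ z → m (m z) ≡ z) → (f : Fin n → ℕ) →
    sumF (λ z → f (m z)) ≡ sumF f
  sum-involution m inv f =
    trans (as-sum (f ∘ m)) (trans (sym (sum-permute f (Permutation.permutation m m inv inv)))
                                  (sym (as-sum f)))
    where
    as-sum : ∀ {n} (g : Fin n → ℕ) → sumF g ≡ sum g
    as-sum {zero}  g = refl
    as-sum {suc n} g = cong (g zero +_) (as-sum (g ∘ suc))

  count-cong : ∀ {n} {A B : VSet n} → (∀ i → A i ≡ B i) → countF A ≡ countF B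
  count-cong {A = A} {B} e =
    trans (count-as-sum A) (trans (sum-cong (cong ⟦_⟧ ∘ e)) (sym (count-as-sum B)))

  indicator-mono : ∀ {a b} → (a ≡ true → b ≡ true) → ⟦ a ⟧ ≤ ⟦ b ⟧
  indicator-mono {true}  a⇒b rewrite a⇒b refl = ≤-refl
  indicator-mono {false} a⇒b = z≤n

  count-mono : ∀ {n} {A B : VSet n} → A ⊆ B → countF A ≤ countF B
  count-mono {A = A} {B} A⊆B rewrite count-as-sum A | count-as-sum B =
    sum-mono (λ i → indicator-mono (A⊆B i))

  count-≤ : ∀ {n} (A : VSet n) → countF A ≤ n
  count-≤ {zero}  A = z≤n
  count-≤ {suc n} A with A zero
  ... | true  = s≤s (count-≤ (A ∘ suc))
  ... | false = ≤-trans (count-≤ (A ∘ suc)) (n≤1+n n)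

  count-strict : ∀ {n} {A B : VSet n} → A ⊆ B → (w : Fin n) → A w ≡ false → B w ≡ true →
    countF A < countF B
  count-strict {suc n} {A} {B} A⊆B zero Aw Bw rewrite Aw | Bw = s≤s (count-mono (A⊆B ∘ suc))
  count-strict {suc n} {A} {B} A⊆B (suc w) Aw Bw =
    +-mono-≤-< (indicator-mono (A⊆B zero)) (count-strict (A⊆B ∘ suc) w Aw Bw)

  count-∪ : ∀ {n} (A B : VSet n) → Disjoint A B → countF (A ∪ B) ≡ countF A + countF B
  count-∪ {zero}  A B d = refl
  count-∪ {suc n} A B d with A zero | B zero | d zero
  ... | true  | false | _ = cong suc (count-∪ (A ∘ suc) (B ∘ suc) (d ∘ suc))
  ... | false | true  | _ = trans (cong suc (count-∪ (A ∘ suc) (B ∘ suc) (d ∘ suc)))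
                                  (sym (+-suc (countF (A ∘ suc)) _))
  ... | false | false | _ = count-∪ (A ∘ suc) (B ∘ suc) (d ∘ suc)

  count-∁ : ∀ {n} (A : VSet n) → countF A + countF (∁ A) ≡ n
  count-∁ {zero}  A = refl
  count-∁ {suc n} A with A zero
  ... | true  = cong suc (count-∁ (A ∘ suc))
  ... | false = trans (+-suc (countF (A ∘ suc)) _) (cong suc (count-∁ (A ∘ suc)))

  count-product : ∀ {n} (A B : VSet n) →
    sumF (λ s → sumF (λ t → ⟦ A s ∧ B t ⟧)) ≡ countF A * countF B
  count-product A B = begin
    sumF (λ s → sumF (λ t → ⟦ A s ∧ B t ⟧))        ≡⟨ sum-cong (λ s → sum-cong (λ t → ⟦∧⟧ (A s) (B t))) ⟩
    sumF (λ s → sumF (λ t → ⟦ A s ⟧ * ⟦ B t ⟧))    ≡⟨ sum-cong (λ s → sum-*ˡ ⟦ A s ⟧ (λ t → ⟦ B t ⟧)) ⟩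
    sumF (λ s → ⟦ A s ⟧ * sumF (λ t → ⟦ B t ⟧))    ≡⟨ sum-cong (λ s → *-comm ⟦ A s ⟧ _) ⟩
    sumF (λ s → sumF (λ t → ⟦ B t ⟧) * ⟦ A s ⟧)    ≡⟨ sum-*ˡ (sumF (λ t → ⟦ B t ⟧)) (λ s → ⟦ A s ⟧) ⟩
    sumF (λ t → ⟦ B t ⟧) * sumF (λ s → ⟦ A s ⟧)    ≡⟨ sym (cong₂ _*_ (count-as-sum B) (count-as-sum A)) ⟩
    countF B * countF A                            ≡⟨ *-comm (countF B) _ ⟩
    countF A * countF B                            ∎
    where
    open ≡-Reasoning
    ⟦∧⟧ : ∀ a b → ⟦ a ∧ b ⟧ ≡ ⟦ a ⟧ * ⟦ b ⟧
    ⟦∧⟧ true  b = sym (+-identityʳ ⟦ b ⟧)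
    ⟦∧⟧ false b = refl

  pairs-bound : ∀ {n} (R : Fin n → Fin n → Bool) (g : Fin n → Fin n → ℕ) →
    (∀ s t → ⟦ R s t ⟧ ≤ g s t) → countPairs R ≤ sumF (λ s → sumF (g s))
  pairs-bound R g le = sum-mono (λ s → subst (_≤ sumF (g s)) (sym (count-as-sum (R s))) (sum-mono (le s)))

  record Selection {n} (A : VSet n) (t : ℕ) : Set where
    field
      chosen      : VSet n
      chosen-⊆    : chosen ⊆ A
      chosen-size : countF chosen ≡ t

  drop-first : ∀ {n t} {A : VSet (suc n)} → Selection (A ∘ suc) t → Selection A t
  drop-first B = record
    { chosen      = λ { zero → false ; (suc i) → chosen B i }
    ; chosen-⊆    = λ { zero () ; (suc i) → chosen-⊆ B i }
    ; chosen-size = chosen-size B }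
    where open Selection

  take-first : ∀ {n t} {A : VSet (suc n)} → A zero ≡ true → Selection (A ∘ suc) t → Selection A (suc t)
  take-first A₀ B = record
    { chosen      = λ { zero → true ; (suc i) → chosen B i }
    ; chosen-⊆    = λ { zero _ → A₀ ; (suc i) → chosen-⊆ B i }
    ; chosen-size = cong suc (chosen-size B) }
    where open Selection

  select : ∀ {n} (A : VSet n) (t : ℕ) → t ≤ countF A → Selection A t
  select {zero}  A zero    _  = record { chosen = λ () ; chosen-⊆ = λ () ; chosen-size = refl }
  select {suc n} A zero    _  = drop-first (select (A ∘ suc) zero z≤n)
  select {suc n} A (suc t) t≤ with A zero in A₀
  ... | true  = take-first A₀ (select (A ∘ suc) t (≤-pred t≤))
  ... | false = drop-first (select (A ∘ suc) (suc t) t≤)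

  search : ∀ {n} (A : VSet n) → (Σ (Fin n) λ i → A i ≡ true) ⊎ (∀ i → A i ≡ false)
  search A with any? (λ i → A i Bool.≟ true)
  ... | yes found = inj₁ found
  ... | no  none  = inj₂ (λ i → ¬-not (λ Ai → none (i , Ai)))

  count-∅ : ∀ {n} → countF {n} (λ _ → false) ≡ 0
  count-∅ {zero}  = refl
  count-∅ {suc n} = count-∅ {n}

  count-singleton : ∀ {n} (u : Fin n) → countF (λ z → does (z ≟ u)) ≡ 1
  count-singleton {suc n} zero = cong suc (trans (count-cong {n} {B = λ _ → false} (λ _ → refl)) (count-∅ {n}))
  count-singleton (suc u)      = count-singleton u

  <ᵇ-irrefl : ∀ i → (i <ᵇ i) ≡ false
  <ᵇ-irrefl zero    = refl
  <ᵇ-irrefl (suc i) = <ᵇ-irrefl i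

  <ᵇ-asym : ∀ i j → ((i <ᵇ j) ∧ (j <ᵇ i)) ≡ false
  <ᵇ-asym zero    zero    = refl
  <ᵇ-asym zero    (suc j) = refl
  <ᵇ-asym (suc i) zero    = refl
  <ᵇ-asym (suc i) (suc j) = <ᵇ-asym i j

  <ᵇ-connex : ∀ i j → i ≢ j → ⟦ i <ᵇ j ⟧ + ⟦ j <ᵇ i ⟧ ≡ 1
  <ᵇ-connex zero    zero    i≢j = ⊥-elim (i≢j refl)
  <ᵇ-connex zero    (suc j) _   = refl
  <ᵇ-connex (suc i) zero    _   = refl
  <ᵇ-connex (suc i) (suc j) i≢j = <ᵇ-connex i j (i≢j ∘ cong suc)

  odd≢even : ∀ c h → suc (c + c) ≢ h + h
  odd≢even zero    zero          ()
  odd≢even zero    (suc h)       e = 0≢1+n (trans (suc-injective e) (+-suc h h))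
  odd≢even (suc c) zero          ()
  odd≢even (suc c) (suc h)       e =
    odd≢even c h (suc-injective (trans (cong suc (sym (+-suc c c))) (trans (suc-injective e) (+-suc h h))))

  twice : ∀ h → h * 2 ≡ h + h
  twice = solve-∀

  -- (h ∸ s) (s + (h ∸ s)) = (h ∸ s) h: either s ≤ h, or the first factor vanishes.
  monus-product : ∀ h s → (h ∸ s) * (s + (h ∸ s)) ≡ (h ∸ s) * h
  monus-product h s with ≤-total s h
  ... | inj₁ s≤h = cong ((h ∸ s) *_) (m+[n∸m]≡n s≤h)
  ... | inj₂ h≤s rewrite m≤n⇒m∸n≡0 h≤s = refl

  Bools : ℕ → Set → Set
  Bools zero    A = A
  Bools (suc k) A = Bool → Bools k A

  -- Relations between numerical expressions in k Boolean variables that are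
  -- required only on the assignments where the expression `excluded` is false,
  -- decided by evaluating all 2ᵏ assignments.
  module TruthTable {_~_ : ℕ → ℕ → Set} (_~ᵇ_ : ℕ → ℕ → Bool) (sound : ∀ m n → T (m ~ᵇ n) → m ~ n) where

    Holds : ∀ k → Bools k Bool → Bools k ℕ → Bools k ℕ → Set
    Holds zero    excluded l r = excluded ≡ false → l ~ r
    Holds (suc k) excluded l r = ∀ b → Holds k (excluded b) (l b) (r b)

    check : ∀ k → Bools k Bool → Bools k ℕ → Bools k ℕ → Bool
    check zero    excluded l r = excluded ∨ (l ~ᵇ r)
    check (suc k) excluded l r = check k (excluded true)  (l true)  (r true)
                               ∧ check k (excluded false) (l false) (r false)

    truth-table : ∀ k {excluded l r} → T (check k excluded l r) → Holds k excluded l r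
    truth-table zero    {true}          _  ()
    truth-table zero    {false} {l} {r} ok _ = sound l r ok
    truth-table (suc k) ok true  = truth-table k (proj₁ (Equivalence.to T-∧ ok))
    truth-table (suc k) ok false = truth-table k (proj₂ (Equivalence.to T-∧ ok))

    Always : ∀ k → Bools k ℕ → Bools k ℕ → Set
    Always zero    l r = l ~ r
    Always (suc k) l r = ∀ b → Always k (l b) (r b)

    nothing : ∀ k → Bools k Bool
    nothing zero    = false
    nothing (suc k) = λ _ → nothing k

    always-by-truth-table : ∀ k {l r} → T (check k (nothing k) l r) → Always k l r
    always-by-truth-table k ok = unconditional k (truth-table k ok)
      where
      unconditional : ∀ k {l r} → Holds k (nothing k) l r → Always k l r
      unconditional zero    holds   = holds refl
      unconditional (suc k) holds b = unconditional k (holds b)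

  open TruthTable _≤ᵇ_ ≤ᵇ⇒≤ using () renaming (truth-table to ≤-by-truth-table)
  open TruthTable _≡ᵇ_ ≡ᵇ⇒≡ using ()
    renaming (truth-table to ≡-by-truth-table; always-by-truth-table to ≡-always-by-truth-table)

  ⊆-excluded : ∀ {n} {A B : VSet n} → A ⊆ B → ∀ i → (A i ∧ not (B i)) ≡ false
  ⊆-excluded {A = A} {B} A⊆B i with A i in Ai
  ... | false = refl
  ... | true  rewrite A⊆B i Ai = refl

  true≢false : ∀ {a} → a ≡ true → a ≡ false → ⊥
  true≢false refl ()

  ∨-false : ∀ {a b} → a ≡ false → b ≡ false → (a ∨ b) ≡ false
  ∨-false refl refl = refl

  implies-∧-false : ∀ {a b} → (a ≡ true → b ≡ false) → (a ∧ b) ≡ false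
  implies-∧-false {false} _   = refl
  implies-∧-false {true}  a⇒b = a⇒b refl

  ∧-true₁ : ∀ {a b} → (a ∧ b) ≡ true → a ≡ true
  ∧-true₁ {true} _ = refl

  ∧-true₂ : ∀ {a b} → (a ∧ b) ≡ true → b ≡ true
  ∧-true₂ {true} ab = ab

  ∧-intro : ∀ {a b} → a ≡ true → b ≡ true → (a ∧ b) ≡ true
  ∧-intro refl refl = refl

  ∨-true : ∀ {a b} → (a ∨ b) ≡ true → a ≡ true ⊎ b ≡ true
  ∨-true {true}  _ = inj₁ refl
  ∨-true {false} b = inj₂ b

  indicator-positive : ∀ {a} → 1 ≤ ⟦ a ⟧ → a ≡ true
  indicator-positive {true} _ = refl

  indicator-⊎ : ∀ {a b c} → (a ≡ true → b ≡ true ⊎ c ≡ true) → ⟦ a ⟧ ≤ ⟦ b ⟧ + ⟦ c ⟧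
  indicator-⊎ {false} _ = z≤n
  indicator-⊎ {true} {b} {c} a⇒b∨c with a⇒b∨c refl
  ... | inj₁ refl = s≤s z≤n
  ... | inj₂ refl = m≤n+m 1 ⟦ b ⟧

  count-cong⟦⟧ : ∀ {n} {A B : VSet n} → (∀ i → ⟦ A i ⟧ ≡ ⟦ B i ⟧) → countF A ≡ countF B
  count-cong⟦⟧ {A = A} {B} e = trans (count-as-sum A) (trans (sum-cong e) (sym (count-as-sum B)))

  count-split : ∀ {n} (B C : VSet n) → countF B ≡ countF (B ∩ C) + countF (B ∩ ∁ C)
  count-split B C = trans (count-cong⟦⟧ (λ i → split (B i) (C i))) (count-∪ (B ∩ C) (B ∩ ∁ C) (λ i → apart (B i) (C i)))
    where
    split : ∀ b c → ⟦ b ⟧ ≡ ⟦ (b ∧ c) ∨ (b ∧ not c) ⟧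
    split = ≡-always-by-truth-table 2 _
    apart : ∀ b c → ((b ∧ c) ∧ (b ∧ not c)) ≡ false
    apart true  c = ∧-inverseʳ c
    apart false c = refl

  count-partition : ∀ {n} (P Q : VSet n) → Disjoint P Q → countF P + countF Q + countF (∁ P ∩ ∁ Q) ≡ n
  count-partition P Q disjoint =
    trans (cong (_+ countF (∁ P ∩ ∁ Q)) (sym (count-∪ P Q disjoint)))
          (trans (cong (countF (P ∪ Q) +_) (count-cong⟦⟧ (λ i → de-morgan (P i) (Q i)))) (count-∁ (P ∪ Q)))
    where
    de-morgan : ∀ p q → ⟦ not p ∧ not q ⟧ ≡ ⟦ not (p ∨ q) ⟧
    de-morgan = ≡-always-by-truth-table 2 _

  complement-half : ∀ {n h} (A : VSet n) → n ≡ h + h → countF A ≡ h → countF (∁ A) ≡ h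
  complement-half {h = h} A n≡h+h |A|≡h =
    +-cancelˡ-≡ h _ _ (trans (cong (_+ countF (∁ A)) (sym |A|≡h)) (trans (count-∁ A) n≡h+h))

  count-⊆-split : ∀ {n} {C L : VSet n} → C ⊆ L → countF L ≡ countF C + countF (L ∩ ∁ C)
  count-⊆-split {C = C} {L} C⊆L =
    trans (count-split L C) (cong (_+ countF (L ∩ ∁ C)) (count-cong⟦⟧ (λ i → inside (L i) (C i) (⊆-excluded C⊆L i))))
    where
    inside : ∀ l c → (c ∧ not l) ≡ false → ⟦ l ∧ c ⟧ ≡ ⟦ c ⟧
    inside = ≡-by-truth-table 2 _

  room-outside : ∀ {n h} (P Q : VSet n) → n ≡ h + h → Disjoint P Q → countF Q ≤ h →
    h ∸ countF P ≤ countF (∁ P ∩ ∁ Q)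
  room-outside {n} {h} P Q n≡h+h disjoint |Q|≤h = begin
    h ∸ countF P                      ≤⟨ ∸-monoˡ-≤ (countF P) h≤|P|+|L| ⟩
    countF P + countF L ∸ countF P    ≡⟨ m+n∸m≡n (countF P) _ ⟩
    countF L                          ∎
    where
    open ≤-Reasoning
    L : VSet n
    L = ∁ P ∩ ∁ Q
    h≤|P|+|L| : h ≤ countF P + countF L
    h≤|P|+|L| = +-cancelʳ-≤ h h _ (begin
      h + h                             ≡⟨ sym n≡h+h ⟩
      n                                 ≡⟨ sym (count-partition P Q disjoint) ⟩
      countF P + countF Q + countF L    ≡⟨ rearrange (countF P) (countF Q) (countF L) ⟩
      countF Q + (countF P + countF L)  ≤⟨ +-monoˡ-≤ _ |Q|≤h ⟩
      h + (countF P + countF L)         ≡⟨ +-comm h _ ⟩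
      countF P + countF L + h           ∎)
      where
      rearrange : ∀ p q l → p + q + l ≡ q + (p + l)
      rearrange = solve-∀

  ⊆∁⇒disjoint : ∀ {n} {A B : VSet n} → B ⊆ ∁ A → Disjoint A B
  ⊆∁⇒disjoint {A = A} {B} B⊆∁A i with A i in Ai | B i in Bi
  ... | false | _     = refl
  ... | true  | false = refl
  ... | true  | true  = case trans (sym (B⊆∁A i Bi)) (cong not Ai) of λ ()

  module SparseSets {n : ℕ} (G : Graph n) where

    edgesF : VSet n → ℕ
    edgesF S = countPairs (λ s t → S s ∧ S t ∧ adj G s t ∧ (toℕ s <ᵇ toℕ t))

    crossF : VSet n → ℕ
    crossF A = countPairs (λ s t → A s ∧ not (A t) ∧ adj G s t)

    NoEdges : VSet n → VSet n → Set
    NoEdges P Q = ∀ s t → (P s ∧ Q t ∧ adj G s t) ≡ false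

    no-edges : ∀ {P Q} → (∀ {s t} → P s ≡ true → Q t ≡ true → adj G s t ≡ true → ⊥) → NoEdges P Q
    no-edges {P} {Q} apart s t with P s in Ps | Q t in Qt | adj G s t in st
    ... | false | _     | _     = refl
    ... | true  | false | _     = refl
    ... | true  | true  | false = refl
    ... | true  | true  | true  = ⊥-elim (apart Ps Qt st)

    -- If S is independent, every edge of G[S ∪ F] has an end in F; orienting
    -- each edge away from such an end shows that G[S ∪ F] has at most
    -- |F| |S ∪ F| edges.
    edges-meeting : (S F : VSet n) → NoEdges S S → edgesF (S ∪ F) ≤ countF F * countF (S ∪ F)
    edges-meeting S F independent = begin
      edgesF (S ∪ F)
        ≤⟨ pairs-bound _ (λ s t → g₁ s t + g₂ s t)
             (λ s t → meets-F (S s) (F s) (S t) (F t) (adj G s t) (lt s t) (independent s t)) ⟩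
      sumF (λ s → sumF (λ t → g₁ s t + g₂ s t))
        ≡⟨ double-sum-+ g₁ g₂ ⟩
      sumF (λ s → sumF (g₁ s)) + sumF (λ s → sumF (g₂ s))
        ≡⟨ cong (sumF (λ s → sumF (g₁ s)) +_) (sum-swap g₂) ⟩
      sumF (λ x → sumF (g₁ x)) + sumF (λ x → sumF (λ y → g₂ y x))
        ≡⟨ sym (double-sum-+ g₁ (λ x y → g₂ y x)) ⟩
      sumF (λ x → sumF (λ y → g₁ x y + g₂ y x))
        ≤⟨ sum-mono (λ x → sum-mono (λ y →
             one-orientation (F x) (S y) (F y) (lt x y) (lt y x) (<ᵇ-asym (toℕ x) (toℕ y)))) ⟩
      sumF (λ x → sumF (λ y → ⟦ F x ∧ (S ∪ F) y ⟧))
        ≡⟨ count-product F (S ∪ F) ⟩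
      countF F * countF (S ∪ F) ∎
      where
      open ≤-Reasoning
      lt : Fin n → Fin n → Bool
      lt s t = toℕ s <ᵇ toℕ t
      g₁ g₂ : Fin n → Fin n → ℕ
      g₁ s t = ⟦ F s ∧ lt s t ∧ (S ∪ F) t ⟧
      g₂ s t = ⟦ S s ∧ lt s t ∧ F t ⟧
      double-sum-+ : (f g : Fin n → Fin n → ℕ) →
        sumF (λ s → sumF (λ t → f s t + g s t)) ≡ sumF (λ s → sumF (f s)) + sumF (λ s → sumF (g s))
      double-sum-+ f g = trans (sum-cong (λ s → sum-+ (f s) (g s))) (sum-+ (λ s → sumF (f s)) (λ s → sumF (g s)))
      meets-F : ∀ Ss Fs St Ft e l → (Ss ∧ St ∧ e) ≡ false →
        ⟦ (Ss ∨ Fs) ∧ (St ∨ Ft) ∧ e ∧ l ⟧ ≤ ⟦ Fs ∧ l ∧ (St ∨ Ft) ⟧ + ⟦ Ss ∧ l ∧ Ft ⟧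
      meets-F = ≤-by-truth-table 6 _
      one-orientation : ∀ Fx Sy Fy l₁ l₂ → (l₁ ∧ l₂) ≡ false →
        ⟦ Fx ∧ l₁ ∧ (Sy ∨ Fy) ⟧ + ⟦ Sy ∧ l₂ ∧ Fx ⟧ ≤ ⟦ Fx ∧ (Sy ∨ Fy) ⟧
      one-orientation = ≤-by-truth-table 5 _

    -- An edge leaving A starts in A and ends outside A; when it starts in P it
    -- avoids Q.  Hence e(A, ∁A) ≤ |A| |∁A ∖ Q| + |A ∖ P| |∁A ∩ Q|.
    cut-bound : (A P Q : VSet n) → NoEdges P Q →
      crossF A ≤ countF A * countF (∁ A ∩ ∁ Q) + countF (A ∩ ∁ P) * countF (∁ A ∩ Q)
    cut-bound A P Q no-edges = begin
      crossF A
        ≤⟨ pairs-bound _ (λ s t → g₁ s t + g₂ s t)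
             (λ s t → leaves-A (A s) (P s) (A t) (Q t) (adj G s t) (no-edges s t)) ⟩
      sumF (λ s → sumF (λ t → g₁ s t + g₂ s t))
        ≡⟨ trans (sum-cong (λ s → sum-+ (g₁ s) (g₂ s))) (sum-+ (λ s → sumF (g₁ s)) (λ s → sumF (g₂ s))) ⟩
      sumF (λ s → sumF (g₁ s)) + sumF (λ s → sumF (g₂ s))
        ≡⟨ cong₂ _+_ (count-product A (∁ A ∩ ∁ Q)) (count-product (A ∩ ∁ P) (∁ A ∩ Q)) ⟩
      countF A * countF (∁ A ∩ ∁ Q) + countF (A ∩ ∁ P) * countF (∁ A ∩ Q) ∎
      where
      open ≤-Reasoning
      g₁ g₂ : Fin n → Fin n → ℕ
      g₁ s t = ⟦ A s ∧ (∁ A ∩ ∁ Q) t ⟧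
      g₂ s t = ⟦ (A ∩ ∁ P) s ∧ (∁ A ∩ Q) t ⟧
      leaves-A : ∀ As Ps At Qt e → (Ps ∧ Qt ∧ e) ≡ false →
        ⟦ As ∧ not At ∧ e ⟧ ≤ ⟦ As ∧ (not At ∧ not Qt) ⟧ + ⟦ (As ∧ not Ps) ∧ (not At ∧ Qt) ⟧
      leaves-A = ≤-by-truth-table 5 _

    extend-independent : ∀ {h} → n ≡ h + h → (S : VSet n) → NoEdges S S →
      Σ (VSet n) λ T → h ≤ countF T × edgesF T ≤ h * (h ∸ countF S)
    extend-independent {h} n≡h+h S independent = S ∪ F , h≤|T| , bound
      where
      s f : ℕ
      s = countF S
      f = h ∸ s
      f≤|∁S| : f ≤ countF (∁ S)
      f≤|∁S| = begin
        h ∸ s                ≤⟨ ∸-monoˡ-≤ s (subst (h ≤_) (sym n≡h+h) (m≤m+n h h)) ⟩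
        n ∸ s                ≡⟨ cong (_∸ s) (sym (count-∁ S)) ⟩
        s + countF (∁ S) ∸ s ≡⟨ m+n∸m≡n s _ ⟩
        countF (∁ S)         ∎
        where open ≤-Reasoning
      open Selection (select (∁ S) f f≤|∁S|) renaming (chosen to F; chosen-⊆ to F⊆∁S; chosen-size to |F|≡f)
      |T|≡s+f : countF (S ∪ F) ≡ s + f
      |T|≡s+f = trans (count-∪ S F (⊆∁⇒disjoint F⊆∁S)) (cong (s +_) |F|≡f)
      h≤|T| : h ≤ countF (S ∪ F)
      h≤|T| = subst (h ≤_) (sym |T|≡s+f) (m≤n+m∸n h s)
      bound : edgesF (S ∪ F) ≤ h * f
      bound = begin
        edgesF (S ∪ F)            ≤⟨ edges-meeting S F independent ⟩
        countF F * countF (S ∪ F) ≡⟨ cong₂ _*_ |F|≡f |T|≡s+f ⟩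
        f * (s + f)               ≡⟨ monus-product h s ⟩
        f * h                     ≡⟨ *-comm f h ⟩
        h * f                     ∎
        where open ≤-Reasoning

    cut-inside : ∀ {h} → n ≡ h + h → (P Q : VSet n) → Disjoint P Q → NoEdges P Q → h ≤ countF P →
      Σ (VSet n) λ A → countF A ≡ h × crossF A ≤ h * (h ∸ countF Q)
    cut-inside {h} n≡h+h P Q disjoint no-edges h≤|P| = A , |A|≡h , (begin
      crossF A
        ≤⟨ cut-bound A P Q no-edges ⟩
      countF A * countF (∁ A ∩ ∁ Q) + countF (A ∩ ∁ P) * countF (∁ A ∩ Q)
        ≡⟨ cong₂ (λ a b → a * countF (∁ A ∩ ∁ Q) + b * countF (∁ A ∩ Q)) |A|≡h |A∖P|≡0 ⟩
      h * countF (∁ A ∩ ∁ Q) + 0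
        ≡⟨ +-identityʳ _ ⟩
      h * countF (∁ A ∩ ∁ Q)
        ≡⟨ cong (h *_) |∁A∖Q| ⟩
      h * (h ∸ countF Q) ∎)
      where
      open ≤-Reasoning
      open Selection (select P h h≤|P|) renaming (chosen to A; chosen-⊆ to A⊆P; chosen-size to |A|≡h)
      |A∖P|≡0 : countF (A ∩ ∁ P) ≡ 0
      |A∖P|≡0 = trans (count-cong (⊆-excluded A⊆P)) (count-∅ {n})
      A∩Q≡∅ : ∀ i → (A i ∧ Q i) ≡ false
      A∩Q≡∅ i with A i in Ai
      ... | false = refl
      ... | true  = trans (sym (cong (_∧ Q i) (A⊆P i Ai))) (disjoint i)
      Q-outside : ∀ a q → (a ∧ q) ≡ false → ⟦ not a ∧ q ⟧ ≡ ⟦ q ⟧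
      Q-outside = ≡-by-truth-table 2 _
      -- Q lies outside A, so ∁ A splits into Q and h ∸ |Q| further vertices.
      |∁A∖Q| : countF (∁ A ∩ ∁ Q) ≡ h ∸ countF Q
      |∁A∖Q| = sym (begin-equality
        h ∸ countF Q
          ≡⟨ cong (_∸ countF Q) (sym (complement-half A n≡h+h |A|≡h)) ⟩
        countF (∁ A) ∸ countF Q
          ≡⟨ cong (_∸ countF Q) (count-split (∁ A) Q) ⟩
        countF (∁ A ∩ Q) + countF (∁ A ∩ ∁ Q) ∸ countF Q
          ≡⟨ cong (λ k → k + countF (∁ A ∩ ∁ Q) ∸ countF Q) (count-cong⟦⟧ (λ i → Q-outside (A i) (Q i) (A∩Q≡∅ i))) ⟩
        countF Q + countF (∁ A ∩ ∁ Q) ∸ countF Q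
          ≡⟨ m+n∸m≡n (countF Q) _ ⟩
        countF (∁ A ∩ ∁ Q) ∎)

    -- For disjoint P, Q without edges from P to Q, both of size at most h
    -- (n = 2h): P together with h ∸ |P| vertices outside P ∪ Q has at most
    -- h |∁P ∖ Q| edges leaving it.
    cut-between : ∀ {h} → n ≡ h + h → (P Q : VSet n) → Disjoint P Q → NoEdges P Q →
      countF P ≤ h → countF Q ≤ h →
      Σ (VSet n) λ A → countF A ≡ h × crossF A ≤ h * countF (∁ P ∩ ∁ Q)
    cut-between {h} n≡h+h P Q disjoint no-edges |P|≤h |Q|≤h = A , |A|≡h , (begin
      crossF A
        ≤⟨ cut-bound A P Q no-edges ⟩
      countF A * countF (∁ A ∩ ∁ Q) + countF (A ∩ ∁ P) * countF (∁ A ∩ Q)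
        ≤⟨ +-monoʳ-≤ (countF A * _) (*-monoʳ-≤ (countF (A ∩ ∁ P)) |∁A∩Q|≤h) ⟩
      countF A * countF (∁ A ∩ ∁ Q) + countF (A ∩ ∁ P) * h
        ≡⟨ cong₂ (λ a c → a * countF (∁ A ∩ ∁ Q) + c * h) |A|≡h |A∖P|≡|C| ⟩
      h * countF (∁ A ∩ ∁ Q) + countF C * h
        ≡⟨ cong (h * countF (∁ A ∩ ∁ Q) +_) (*-comm (countF C) h) ⟩
      h * countF (∁ A ∩ ∁ Q) + h * countF C
        ≡⟨ sym (*-distribˡ-+ h _ _) ⟩
      h * (countF (∁ A ∩ ∁ Q) + countF C)
        ≡⟨ cong (h *_) |L| ⟩
      h * countF L ∎)
      where
      open ≤-Reasoning
      L : VSet n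
      L = ∁ P ∩ ∁ Q
      open Selection (select L (h ∸ countF P) (room-outside P Q n≡h+h disjoint |Q|≤h))
        renaming (chosen to C; chosen-⊆ to C⊆L; chosen-size to |C|≡h∸|P|)
      A : VSet n
      A = P ∪ C
      C⊆∁P : C ⊆ ∁ P
      C⊆∁P i Ci with P i | C⊆L i Ci
      ... | false | _ = refl
      |A|≡h : countF A ≡ h
      |A|≡h = trans (count-∪ P C (⊆∁⇒disjoint C⊆∁P))
                    (trans (cong (countF P +_) |C|≡h∸|P|) (m+[n∸m]≡n |P|≤h))
      |∁A∩Q|≤h : countF (∁ A ∩ Q) ≤ h
      |∁A∩Q|≤h = ≤-trans (count-mono {B = ∁ A} (λ i → ∧-true₁)) (≤-reflexive (complement-half A n≡h+h |A|≡h))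
      C-part : ∀ p c → (p ∧ c) ≡ false → ⟦ (p ∨ c) ∧ not p ⟧ ≡ ⟦ c ⟧
      C-part = ≡-by-truth-table 2 _
      |A∖P|≡|C| : countF (A ∩ ∁ P) ≡ countF C
      |A∖P|≡|C| = count-cong⟦⟧ (λ i → C-part (P i) (C i) (⊆∁⇒disjoint C⊆∁P i))
      outside : ∀ p q c → ⟦ (not p ∧ not q) ∧ not c ⟧ ≡ ⟦ not (p ∨ c) ∧ not q ⟧
      outside = ≡-always-by-truth-table 3 _
      -- L splits into C and the part of ∁ A outside Q.
      |L| : countF (∁ A ∩ ∁ Q) + countF C ≡ countF L
      |L| = sym (begin-equality
        countF L                        ≡⟨ count-⊆-split C⊆L ⟩
        countF C + countF (L ∩ ∁ C)     ≡⟨ cong (countF C +_) (count-cong⟦⟧ (λ i → outside (P i) (Q i) (C i))) ⟩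
        countF C + countF (∁ A ∩ ∁ Q)   ≡⟨ +-comm (countF C) _ ⟩
        countF (∁ A ∩ ∁ Q) + countF C   ∎)

    data Extremal (h bound : ℕ) : Set where
      sparse-set : (S : VSet n) → h ≤ countF S → 4 * edgesF S ≤ bound → Extremal h bound
      sparse-cut : (A : VSet n) → countF A ≡ h → 4 * crossF A ≤ bound → Extremal h bound

  module Matchings {n : ℕ} (G : Graph n) where

    Adjacent : Fin n → Fin n → Set
    Adjacent a b = adj G a b ≡ true

    adjacent-distinct : ∀ {a b} → Adjacent a b → a ≢ b
    adjacent-distinct {a} ab refl = true≢false ab (irrefl G a)

    adjacent-sym : ∀ {a b} → Adjacent a b → Adjacent b a
    adjacent-sym {a} {b} ab = trans (Graph.sym G b a) ab

    -- A partial matching: an involution on the vertices whose non-fixed points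
    -- are adjacent to their image; fixed points are the unmatched vertices.
    record PartialMatching : Set where
      field
        mate            : Fin n → Fin n
        mate-involutive : ∀ z → mate (mate z) ≡ z
        mate-adjacent   : ∀ z → mate z ≡ z ⊎ Adjacent z (mate z)
    open PartialMatching public

    Unmatched Matched : PartialMatching → Fin n → Set
    Unmatched M z = mate M z ≡ z
    Matched   M z = mate M z ≢ z

    unmatched : PartialMatching → VSet n
    unmatched M z = does (mate M z ≟ z)

    unmatched-∈ : ∀ M {z} → Unmatched M z → unmatched M z ≡ true
    unmatched-∈ M {z} = dec-true (mate M z ≟ z)

    matched-∉ : ∀ M {z} → Matched M z → unmatched M z ≡ false
    matched-∉ M {z} = dec-false (mate M z ≟ z)

    ∈-unmatched : ∀ M {z} → unmatched M z ≡ true → Unmatched M z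
    ∈-unmatched M {z} with mate M z ≟ z
    ... | yes u = λ _ → u

    matched-mate : ∀ M {x} → Matched M x → Matched M (mate M x)
    matched-mate M {x} mx e = mx (trans (sym e) (mate-involutive M x))

    matched-mate⁻¹ : ∀ M {x} → Matched M (mate M x) → Matched M x
    matched-mate⁻¹ M mx' ux = mx' (cong (mate M) ux)

    unmatched≢matched : ∀ M {w x} → Unmatched M w → Matched M x → w ≢ x
    unmatched≢matched M uw mx refl = mx uw

    -- relink m a b: match a with b; the former partner of b is left unmatched.
    relink : (Fin n → Fin n) → Fin n → Fin n → Fin n → Fin n
    relink m a b z with z ≟ a | z ≟ b | z ≟ m b
    ... | yes _ | _     | _     = b
    ... | no _  | yes _ | _     = a
    ... | no _  | no _  | yes _ = z
    ... | no _  | no _  | no _  = m z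

    module Relink (m : Fin n → Fin n) (inv : ∀ z → m (m z) ≡ z) {a b : Fin n}
                  (ua : m a ≡ a) (a≢b : a ≢ b) where

      mb≢a : m b ≢ a
      mb≢a e = a≢b (trans (sym (trans (cong m e) ua)) (inv b))

      at-a : relink m a b a ≡ b
      at-a with a ≟ a
      ... | yes _  = refl
      ... | no a≢a = ⊥-elim (a≢a refl)

      at-b : relink m a b b ≡ a
      at-b with b ≟ a | b ≟ b
      ... | yes b≡a | _     = ⊥-elim (a≢b (sym b≡a))
      ... | no _    | yes _ = refl
      ... | no _    | no b≢b = ⊥-elim (b≢b refl)

      at-mb : m b ≢ b → relink m a b (m b) ≡ m b
      at-mb mb≢b with m b ≟ a | m b ≟ b | m b ≟ m b
      ... | yes e | _     | _     = ⊥-elim (mb≢a e)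
      ... | no _  | yes e | _     = ⊥-elim (mb≢b e)
      ... | no _  | no _  | yes _ = refl
      ... | no _  | no _  | no ne = ⊥-elim (ne refl)

      elsewhere : ∀ {z} → z ≢ a → z ≢ b → z ≢ m b → relink m a b z ≡ m z
      elsewhere {z} z≢a z≢b z≢mb with z ≟ a | z ≟ b | z ≟ m b
      ... | yes e | _     | _     = ⊥-elim (z≢a e)
      ... | no _  | yes e | _     = ⊥-elim (z≢b e)
      ... | no _  | no _  | yes e = ⊥-elim (z≢mb e)
      ... | no _  | no _  | no _  = refl

      data Position (z : Fin n) : Set where
        is-a     : z ≡ a → Position z
        is-b     : z ≡ b → Position z
        is-mb    : z ≡ m b → z ≢ b → Position z
        is-other : z ≢ a → z ≢ b → z ≢ m b → Position z

      position : ∀ z → Position z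
      position z with z ≟ a | z ≟ b | z ≟ m b
      ... | yes e | _     | _     = is-a e
      ... | no _  | yes e | _     = is-b e
      ... | no _  | no z≢b | yes e = is-mb e z≢b
      ... | no z≢a | no z≢b | no z≢mb = is-other z≢a z≢b z≢mb

      involutive : ∀ z → relink m a b (relink m a b z) ≡ z
      involutive z with position z
      ... | is-a refl = trans (cong (relink m a b) at-a) at-b
      ... | is-b refl = trans (cong (relink m a b) at-b) at-a
      ... | is-mb refl mb≢b = trans (cong (relink m a b) (at-mb mb≢b)) (at-mb mb≢b)
      ... | is-other z≢a z≢b z≢mb =
        trans (cong (relink m a b) (elsewhere z≢a z≢b z≢mb))
              (trans (elsewhere (λ e → z≢a (trans (sym (inv z)) (trans (cong m e) ua)))
                                (λ e → z≢mb (trans (sym (inv z)) (cong m e)))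
                                (λ e → z≢b (trans (sym (inv z)) (trans (cong m e) (inv b)))))
                     (inv z))

      fixed : ∀ z → relink m a b z ≡ z → z ≢ a × z ≢ b × (z ≡ m b ⊎ m z ≡ z)
      fixed z e with position z
      ... | is-a refl = ⊥-elim (a≢b (trans (sym e) at-a))
      ... | is-b refl = ⊥-elim (a≢b (trans (sym at-b) e))
      ... | is-mb z≡mb z≢b = (λ z≡a → mb≢a (trans (sym z≡mb) z≡a)) , z≢b , inj₁ z≡mb
      ... | is-other z≢a z≢b z≢mb = z≢a , z≢b , inj₂ (trans (sym (elsewhere z≢a z≢b z≢mb)) e)

    rematch : (M : PartialMatching) {a b : Fin n} → Unmatched M a → Adjacent a b → PartialMatching
    rematch M {a} {b} ua ab = record
      { mate            = relink (mate M) a b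
      ; mate-involutive = involutive
      ; mate-adjacent   = adjacent }
      where
      open Relink (mate M) (mate-involutive M) ua (adjacent-distinct ab)
      adjacent : ∀ z → relink (mate M) a b z ≡ z ⊎ Adjacent z (relink (mate M) a b z)
      adjacent z with position z
      ... | is-a refl = inj₂ (subst (Adjacent z) (sym at-a) ab)
      ... | is-b refl = inj₂ (subst (Adjacent z) (sym at-b) (adjacent-sym ab))
      ... | is-mb refl mb≢b = inj₁ (at-mb mb≢b)
      ... | is-other z≢a z≢b z≢mb rewrite elsewhere z≢a z≢b z≢mb = mate-adjacent M z

    module Rematch (M : PartialMatching) {a b : Fin n} (ua : Unmatched M a) (ab : Adjacent a b) where
      open Relink (mate M) (mate-involutive M) ua (adjacent-distinct ab) public
        using (fixed; elsewhere)

      frees : Matched M b → Unmatched (rematch M ua ab) (mate M b)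
      frees = Relink.at-mb (mate M) (mate-involutive M) ua (adjacent-distinct ab)

      matches : Matched (rematch M ua ab) a
      matches e = adjacent-distinct ab (sym (trans (sym (Relink.at-a (mate M) (mate-involutive M) ua (adjacent-distinct ab))) e))

    -- An augmenting path starting at the unmatched vertex a, recorded by the
    -- matchings met while flipping it: each step adds a non-matching edge ax and
    -- continues from x's former partner; the last edge ends at an unmatched vertex.
    data AugmentingPath (M : PartialMatching) (a : Fin n) : Set where
      finish : Unmatched M a → (b : Fin n) → Unmatched M b → Adjacent a b → AugmentingPath M a
      extend : (ua : Unmatched M a) (x : Fin n) → Matched M x → (ax : Adjacent a x) →
               AugmentingPath (rematch M ua ax) (mate M x) → AugmentingPath M a

    record Improvement (M : PartialMatching) (a : Fin n) : Set where
      field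
        improved   : PartialMatching
        unmatched-⊆ : ∀ z → Unmatched improved z → Unmatched M z
        start-was-unmatched : Unmatched M a
        start-matched : Matched improved a

    augment : ∀ {M a} → AugmentingPath M a → Improvement M a
    augment {M} {a} (finish ua b ub ab) = record
      { improved = rematch M ua ab
      ; unmatched-⊆ = λ z uz → case fixed z uz of λ where
          (_ , z≢b , inj₁ z≡mb) → ⊥-elim (z≢b (trans z≡mb ub))
          (_ , _   , inj₂ u)    → u
      ; start-was-unmatched = ua
      ; start-matched = matches }
      where open Rematch M ua ab
    augment {M} {a} (extend ua x mx ax path) = record
      { improved = improved
      ; unmatched-⊆ = λ z uz → case fixed z (unmatched-⊆ z uz) of λ where
          (_ , _ , inj₁ z≡mx) → ⊥-elim (start-matched (subst (Unmatched improved) z≡mx uz))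
          (_ , _ , inj₂ u)    → u
      ; start-was-unmatched = ua
      ; start-matched = λ ua' → proj₁ (fixed a (unmatched-⊆ a ua')) refl }
      where
      open Rematch M ua ax
      open Improvement (augment path)

    fewer-unmatched : ∀ {M a} (I : Improvement M a) →
      countF (unmatched (Improvement.improved I)) < countF (unmatched M)
    fewer-unmatched {M} {a} I = count-strict
      (λ z p → unmatched-∈ M (unmatched-⊆ z (∈-unmatched improved p)))
      a (matched-∉ improved start-matched) (unmatched-∈ M start-was-unmatched)
      where open Improvement I

    -- Matched vertices come in pairs: with n even, the number of unmatched
    -- vertices is even, so an unmatched vertex is never the only one.
    module _ (M : PartialMatching) where

      private
        before : Fin n → Bool
        before z = toℕ z <ᵇ toℕ (mate M z)

        matched-split : ∀ z → ⟦ ∁ (unmatched M) z ⟧ ≡ ⟦ before z ⟧ + ⟦ before (mate M z) ⟧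
        matched-split z with mate M z ≟ z
        ... | yes mz≡z rewrite mz≡z | mz≡z | <ᵇ-irrefl (toℕ z) = refl
        ... | no  mz≢z rewrite mate-involutive M z =
              sym (<ᵇ-connex (toℕ z) (toℕ (mate M z)) (λ e → mz≢z (sym (toℕ-injective e))))

      -- Counting each matched pair at its end with the smaller index.
      matched-count : Σ ℕ λ c → countF (∁ (unmatched M)) ≡ c + c
      matched-count = c , (begin
        countF (∁ (unmatched M))                          ≡⟨ count-as-sum (∁ (unmatched M)) ⟩
        sumF (λ z → ⟦ ∁ (unmatched M) z ⟧)                ≡⟨ sum-cong matched-split ⟩
        sumF (λ z → ⟦ before z ⟧ + ⟦ before (mate M z) ⟧) ≡⟨ sum-+ (λ z → ⟦ before z ⟧) (λ z → ⟦ before (mate M z) ⟧) ⟩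
        c + sumF (λ z → ⟦ before (mate M z) ⟧)            ≡⟨ cong (c +_) (sum-involution (mate M) (mate-involutive M) (λ z → ⟦ before z ⟧)) ⟩
        c + c                                             ∎)
        where
        open ≡-Reasoning
        c : ℕ
        c = sumF (λ z → ⟦ before z ⟧)

      -- Otherwise n = 1 + 2c would be odd.
      another-unmatched : ∀ {h} → n ≡ h + h → ∀ {u} → Unmatched M u →
        Σ (Fin n) λ v → Unmatched M v × u ≢ v
      another-unmatched {h} n≡h+h {u} uu with search (λ z → unmatched M z ∧ not (does (z ≟ u)))
      ... | inj₁ (v , p) with unmatched M v in uv | v ≟ u
      ...   | true | no v≢u = v , ∈-unmatched M uv , (λ e → v≢u (sym e))
      another-unmatched {h} n≡h+h {u} uu | inj₂ none =
        ⊥-elim (odd≢even c h (begin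
          suc (c + c)                                       ≡⟨ cong (_+ (c + c)) (sym only-u) ⟩
          countF (unmatched M) + (c + c)                    ≡⟨ cong (countF (unmatched M) +_) (sym c+c) ⟩
          countF (unmatched M) + countF (∁ (unmatched M))   ≡⟨ count-∁ (unmatched M) ⟩
          n                                                 ≡⟨ n≡h+h ⟩
          h + h                                             ∎))
        where
        open ≡-Reasoning
        c : ℕ
        c = proj₁ matched-count
        c+c : countF (∁ (unmatched M)) ≡ c + c
        c+c = proj₂ matched-count
        is-u : ∀ z → unmatched M z ≡ does (z ≟ u)
        is-u z with z ≟ u | none z
        ... | yes refl | _ = unmatched-∈ M uu
        ... | no _     | p = trans (sym (∧-true (unmatched M z))) p
        only-u : countF (unmatched M) ≡ 1
        only-u = trans (count-cong is-u) (count-singleton u)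

    NoPath₁ NoPath₃ NoPath₅ : PartialMatching → Set
    NoPath₁ M = ∀ {w w'} → Unmatched M w → Unmatched M w' → adj G w w' ≡ false
    NoPath₃ M = ∀ {w w' x} → Unmatched M w → Unmatched M w' → w ≢ w' →
                Adjacent w x → adj G w' (mate M x) ≡ false
    NoPath₅ M = ∀ {w w' z y} → Unmatched M w → Unmatched M w' → w ≢ w' → y ≢ mate M z →
                Adjacent w (mate M z) → Adjacent z y → adj G w' (mate M y) ≡ false

    record NoShortAugmentingPath (M : PartialMatching) : Set where
      field
        no-path₁ : NoPath₁ M
        no-path₃ : NoPath₃ M
        no-path₅ : NoPath₅ M

    unmatched? : ∀ M w → Dec (Unmatched M w)
    unmatched? M w = mate M w ≟ w

    adjacent? : ∀ a b → Dec (Adjacent a b)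
    adjacent? a b = adj G a b Bool.≟ true

    module ShortPaths (M : PartialMatching) (no-path₁ : NoPath₁ M) where

      matched-neighbour : ∀ {w x} → Unmatched M w → Adjacent w x → Matched M x
      matched-neighbour uw wx ux = case trans (sym wx) (no-path₁ uw ux) of λ ()

      path₃ : ∀ {w w' x} → Unmatched M w → Unmatched M w' → w ≢ w' →
              Adjacent w x → Adjacent w' (mate M x) → AugmentingPath M w
      path₃ {w} {w'} {x} uw uw' w≢w' wx w'x' =
        extend uw x mx wx (finish (frees mx) w' uw'₁ (adjacent-sym w'x'))
        where
        open Rematch M uw wx
        mx : Matched M x
        mx = matched-neighbour uw wx
        uw'₁ : Unmatched (rematch M uw wx) w'
        uw'₁ = trans (elsewhere (w≢w' ∘ sym) (unmatched≢matched M uw' mx)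
                                (unmatched≢matched M uw' (matched-mate M mx))) uw'

      path₅ : ∀ {w w' z y} → Unmatched M w → Unmatched M w' → w ≢ w' → y ≢ mate M z →
              Adjacent w (mate M z) → Adjacent z y → Adjacent w' (mate M y) → AugmentingPath M w
      path₅ {w} {w'} {z} {y} uw uw' w≢w' y≢z' wz' zy w'y' =
        extend uw (mate M z) mz' wz'
          (subst (AugmentingPath M₁) (sym (mate-involutive M z))
            (extend uz₁ y my₁ zy
              (subst (AugmentingPath M₂) (sym mate₁y)
                (finish (subst (Unmatched M₂) mate₁y (R₂.frees my₁)) w' uw'₂
                        (adjacent-sym w'y')))))
        where
        mz' : Matched M (mate M z)
        mz' = matched-neighbour uw wz'
        my' : Matched M (mate M y)
        my' = matched-neighbour uw' w'y'
        my : Matched M y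
        my = matched-mate⁻¹ M my'
        mz : Matched M z
        mz = matched-mate⁻¹ M mz'
        M₁ : PartialMatching
        M₁ = rematch M uw wz'
        module R₁ = Rematch M uw wz'
        uz₁ : Unmatched M₁ z
        uz₁ = subst (Unmatched M₁) (mate-involutive M z) (R₁.frees mz')
        M₂ : PartialMatching
        M₂ = rematch M₁ uz₁ zy
        module R₂ = Rematch M₁ uz₁ zy
        mate₁y : mate M₁ y ≡ mate M y
        mate₁y = R₁.elsewhere (unmatched≢matched M uw my ∘ sym) y≢z'
                   (λ e → adjacent-distinct zy (sym (trans e (mate-involutive M z))))
        my₁ : Matched M₁ y
        my₁ e = my (trans (sym mate₁y) e)
        uw'₁ : Unmatched M₁ w'
        uw'₁ = trans (R₁.elsewhere (w≢w' ∘ sym) (unmatched≢matched M uw' mz')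
                       (λ e → unmatched≢matched M uw' mz (trans e (mate-involutive M z)))) uw'
        uw'₂ : Unmatched M₂ w'
        uw'₂ = trans (R₂.elsewhere (unmatched≢matched M uw' mz) (unmatched≢matched M uw' my)
                       (λ e → unmatched≢matched M uw' my' (trans e mate₁y))) uw'₁

      path₃? : (Σ (Fin n) (AugmentingPath M)) ⊎ NoPath₃ M
      path₃? with any? (λ w → any? λ w' → any? λ x →
                    unmatched? M w ×-dec unmatched? M w' ×-dec ¬? (w ≟ w') ×-dec
                    adjacent? w x ×-dec adjacent? w' (mate M x))
      ... | yes (w , w' , x , uw , uw' , w≢w' , wx , w'x') = inj₁ (w , path₃ uw uw' w≢w' wx w'x')
      ... | no none = inj₂ λ uw uw' w≢w' wx → ¬-not λ e → none (_ , _ , _ , uw , uw' , w≢w' , wx , e)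

      path₅? : (Σ (Fin n) (AugmentingPath M)) ⊎ NoPath₅ M
      path₅? with any? (λ w → any? λ w' → any? λ z → any? λ y →
                    unmatched? M w ×-dec unmatched? M w' ×-dec ¬? (w ≟ w') ×-dec ¬? (y ≟ mate M z) ×-dec
                    adjacent? w (mate M z) ×-dec adjacent? z y ×-dec adjacent? w' (mate M y))
      ... | yes (w , w' , z , y , uw , uw' , w≢w' , y≢z' , wz' , zy , w'y') =
            inj₁ (w , path₅ uw uw' w≢w' y≢z' wz' zy w'y')
      ... | no none = inj₂ λ uw uw' w≢w' y≢z' wz' zy → ¬-not λ e →
                        none (_ , _ , _ , _ , uw , uw' , w≢w' , y≢z' , wz' , zy , e)

    path₁? : (M : PartialMatching) → (Σ (Fin n) (AugmentingPath M)) ⊎ NoPath₁ M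
    path₁? M with any? (λ w → any? λ w' → unmatched? M w ×-dec unmatched? M w' ×-dec adjacent? w w')
    ... | yes (w , w' , uw , uw' , ww') = inj₁ (w , finish uw w' uw' ww')
    ... | no none = inj₂ λ uw uw' → ¬-not λ e → none (_ , _ , uw , uw' , e)

    short-augmenting-path? : (M : PartialMatching) →
      (Σ (Fin n) (AugmentingPath M)) ⊎ NoShortAugmentingPath M
    short-augmenting-path? M with path₁? M
    ... | inj₁ path = inj₁ path
    ... | inj₂ no₁ with ShortPaths.path₃? M no₁ | ShortPaths.path₅? M no₁
    ...   | inj₁ path | _         = inj₁ path
    ...   | inj₂ _    | inj₁ path = inj₁ path
    ...   | inj₂ no₃  | inj₂ no₅  = inj₂ record { no-path₁ = no₁ ; no-path₃ = no₃ ; no-path₅ = no₅ }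

    record StuckMatching : Set where
      field
        matching      : PartialMatching
        no-short-path : NoShortAugmentingPath matching
        u v           : Fin n
        u-unmatched   : Unmatched matching u
        v-unmatched   : Unmatched matching v
        u≢v           : u ≢ v

    -- For n even: G has a perfect matching or a stuck matching.  Starting from
    -- the empty matching, augment along short paths while possible; each step
    -- matches more vertices.
    perfect-or-stuck : ∀ {h} → n ≡ h + h → PerfectMatching G ⊎ StuckMatching
    perfect-or-stuck {h} n≡h+h = run n empty (count-≤ (unmatched empty))
      where
      empty : PartialMatching
      empty = record { mate = λ z → z ; mate-involutive = λ _ → refl ; mate-adjacent = λ _ → inj₁ refl }

      Result : Set
      Result = PerfectMatching G ⊎ StuckMatching

      step : (M : PartialMatching) →
        ((M' : PartialMatching) → countF (unmatched M') < countF (unmatched M) → Result) → Result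
      step M recurse with search (unmatched M)
      ... | inj₂ none = inj₁ (mate M , mate-involutive M , edge)
        where
        edge : ∀ z → Adjacent z (mate M z)
        edge z = case mate-adjacent M z of λ where
          (inj₁ uz) → case trans (sym (unmatched-∈ M uz)) (none z) of λ ()
          (inj₂ e)  → e
      ... | inj₁ (u , u∈) with short-augmenting-path? M
      ...   | inj₁ (_ , path) = recurse (Improvement.improved I) (fewer-unmatched I)
        where I = augment path
      ...   | inj₂ stuck = inj₂ record
              { matching = M ; no-short-path = stuck ; u = u ; v = proj₁ other
              ; u-unmatched = uu ; v-unmatched = proj₁ (proj₂ other) ; u≢v = proj₂ (proj₂ other) }
        where
        uu : Unmatched M u
        uu = ∈-unmatched M u∈
        other : Σ (Fin n) λ v → Unmatched M v × u ≢ v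
        other = another-unmatched M {h} n≡h+h uu

      run : ∀ fuel (M : PartialMatching) → countF (unmatched M) ≤ fuel → Result
      run zero       M bound = step M λ M' fewer → ⊥-elim (n≮0 (≤-trans fewer bound))
      run (suc fuel) M bound = step M λ M' fewer → run fuel M' (≤-pred (≤-trans fewer bound))

  irregular-bound : ∀ r c p q n d → 2 * r + (c + 2 * (p + q)) ≤ 2 * n →
    n ≤ p + p + d → n ≤ q + q + d → c + 2 * r ≤ 2 * d
  irregular-bound r c p q n d total n≤2p+d n≤2q+d = +-cancelʳ-≤ (2 * (p + q)) _ _ (begin
    c + 2 * r + 2 * (p + q)           ≡⟨ regroup r c (p + q) ⟩
    2 * r + (c + 2 * (p + q))         ≤⟨ total ⟩
    2 * n                             ≡⟨ cong (n +_) (+-identityʳ n) ⟩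
    n + n                             ≤⟨ +-mono-≤ n≤2p+d n≤2q+d ⟩
    p + p + d + (q + q + d)           ≡⟨ collect p q d ⟩
    2 * d + 2 * (p + q)               ∎)
    where
    open ≤-Reasoning
    regroup : ∀ r c t → c + 2 * r + 2 * t ≡ 2 * r + (c + 2 * t)
    regroup = solve-∀
    collect : ∀ p q d → p + p + d + (q + q + d) ≡ 2 * d + 2 * (p + q)
    collect = solve-∀

  deficit : ∀ {n h deg x c s} d → n ≡ h + h → n ≤ deg + deg + d → deg ≤ x + c → x ≤ s →
    2 * (h ∸ s) ≤ d + 2 * c
  deficit {n} {h} {deg} {x} {c} {s} d n≡h+h n≤ deg≤ x≤s = begin
    2 * (h ∸ s)                  ≡⟨ *-distribˡ-∸ 2 h s ⟩
    2 * h ∸ 2 * s                ≤⟨ ∸-monoʳ-≤ (2 * h) (*-monoʳ-≤ 2 x≤s) ⟩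
    2 * h ∸ 2 * x                ≤⟨ ∸-monoˡ-≤ (2 * x) 2h≤ ⟩
    2 * x + (d + 2 * c) ∸ 2 * x  ≡⟨ m+n∸m≡n (2 * x) _ ⟩
    d + 2 * c                    ∎
    where
    open ≤-Reasoning
    2h≤ : 2 * h ≤ 2 * x + (d + 2 * c)
    2h≤ = begin
      2 * h                      ≡⟨ cong (h +_) (+-identityʳ h) ⟩
      h + h                      ≡⟨ sym n≡h+h ⟩
      n                          ≤⟨ n≤ ⟩
      deg + deg + d              ≤⟨ +-monoˡ-≤ d (+-mono-≤ deg≤ deg≤) ⟩
      x + c + (x + c) + d        ≡⟨ regroup x c d ⟩
      2 * x + (d + 2 * c)        ∎
      where
      regroup : ∀ x c d → x + c + (x + c) + d ≡ 2 * x + (d + 2 * c)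
      regroup = solve-∀

  error-bound : ∀ {n h E k} d → n ≡ h + h → E ≤ h * k → 2 * k ≤ 5 * d → 4 * E ≤ n * (5 * d)
  error-bound {n} {h} {E} {k} d n≡h+h E≤hk 2k≤5d = begin
    4 * E                  ≤⟨ *-monoʳ-≤ 4 E≤hk ⟩
    4 * (h * k)            ≡⟨ regroup h k ⟩
    (h + h) * (2 * k)      ≤⟨ *-monoʳ-≤ (h + h) 2k≤5d ⟩
    (h + h) * (5 * d)      ≡⟨ cong (_* (5 * d)) (sym n≡h+h) ⟩
    n * (5 * d)            ∎
    where
    open ≤-Reasoning
    regroup : ∀ h k → 4 * (h * k) ≡ (h + h) * (2 * k)
    regroup = solve-∀

  slack₁ : ∀ {c r} d → c + 2 * r ≤ 2 * d → d + 2 * c ≤ 5 * d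
  slack₁ {c} {r} d c+2r≤2d = begin
    d + 2 * c          ≤⟨ +-monoʳ-≤ d (*-monoʳ-≤ 2 (≤-trans (m≤m+n c (2 * r)) c+2r≤2d)) ⟩
    d + 2 * (2 * d)    ≡⟨ regroup d ⟩
    5 * d              ∎
    where
    open ≤-Reasoning
    regroup : ∀ d → d + 2 * (2 * d) ≡ 5 * d
    regroup = solve-∀

  slack₂ : ∀ {c r} d → c + 2 * r ≤ 2 * d → 2 * (c + r) ≤ 5 * d
  slack₂ {c} {r} d c+2r≤2d = begin
    2 * (c + r)        ≤⟨ *-monoʳ-≤ 2 (+-monoʳ-≤ c (m≤m+n r r)) ⟩
    2 * (c + (r + r))  ≡⟨ cong (λ k → 2 * (c + k)) (cong (r +_) (sym (+-identityʳ r))) ⟩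
    2 * (c + 2 * r)    ≤⟨ *-monoʳ-≤ 2 c+2r≤2d ⟩
    2 * (2 * d)        ≡⟨ regroup d ⟩
    4 * d              ≤⟨ *-monoˡ-≤ d (n≤1+n 4) ⟩
    5 * d              ∎
    where
    open ≤-Reasoning
    regroup : ∀ d → 2 * (2 * d) ≡ 4 * d
    regroup = solve-∀

  -- None of the four patterns "x sees u and v", "x' sees u and v", "x and x'
  -- see u", "x and x' see v" occurs at a matching edge xx', given by whether
  -- x sees u (a₁), x sees v (b₁), x' sees u (a₂), x' sees v (b₂).
  irregular : Bool → Bool → Bool → Bool → Bool
  irregular a₁ b₁ a₂ b₂ = not (a₁ ∧ b₁ ∨ a₂ ∧ b₂ ∨ a₁ ∧ a₂ ∨ b₁ ∧ b₂)

  module Structure {n : ℕ} (G : Graph n) {h : ℕ} (d : ℕ) (n≡h+h : n ≡ h + h)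
    (min-degree : ∀ x → n ≤ degree G x + degree G x + d)
    (stuck : Matchings.StuckMatching G) where

    open Matchings G
    open SparseSets G
    open StuckMatching stuck
    open NoShortAugmentingPath no-short-path

    M : PartialMatching
    M = matching
    m : Fin n → Fin n
    m = mate M

    a b U : VSet n
    a = adj G u
    b = adj G v
    U = unmatched M

    X Y P Q R : VSet n
    X x = a x ∧ b x
    Y x = X (m x)
    P x = a x ∧ a (m x)
    Q x = b x ∧ b (m x)
    R x = not (U x) ∧ irregular (a x) (b x) (a (m x)) (b (m x))

    blind-u : ∀ {x} → Unmatched M x → a x ≡ false
    blind-u = no-path₁ u-unmatched
    blind-v : ∀ {x} → Unmatched M x → b x ≡ false
    blind-v = no-path₁ v-unmatched

    -- No augmenting path u, x, x', v or v, x, x', u.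
    crossing-u : ∀ {x} → a x ≡ true → b (m x) ≡ false
    crossing-u = no-path₃ u-unmatched v-unmatched u≢v
    crossing-v : ∀ {x} → b x ≡ true → a (m x) ≡ false
    crossing-v = no-path₃ v-unmatched u-unmatched (u≢v ∘ sym)

    uncrossed : ∀ x → (a x ∧ b (m x) ∨ b x ∧ a (m x)) ≡ false
    uncrossed x = ∨-false (implies-∧-false crossing-u) (implies-∧-false crossing-v)

    -- No augmenting path u, z', z, y, y', v (and symmetrically).
    long-u : ∀ {z y} → y ≢ m z → a (m z) ≡ true → Adjacent z y → b (m y) ≡ false
    long-u = no-path₅ u-unmatched v-unmatched u≢v
    long-v : ∀ {z y} → y ≢ m z → b (m z) ≡ true → Adjacent z y → a (m y) ≡ false
    long-v = no-path₅ v-unmatched u-unmatched (u≢v ∘ sym)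

    by-cases : ∀ {ℓ} (C : Fin n → Set ℓ) → (∀ {x} → Unmatched M x → C x) → (∀ {x} → Matched M x → C x) →
      ∀ x → C x
    by-cases C unmatched-case matched-case x with unmatched? M x
    ... | yes ux = unmatched-case ux
    ... | no  mx = matched-case mx

    -- Each vertex contributes at most 2 to 2|U| + |R| + deg u + deg v, counting
    -- each matching edge from both ends.
    local-count : ∀ x → 2 * ⟦ U x ⟧ + (⟦ R x ⟧ + (⟦ a x ⟧ + ⟦ b x ⟧ + (⟦ a (m x) ⟧ + ⟦ b (m x) ⟧))) ≤ 2
    local-count = by-cases _ unmatched-case matched-case
      where
      unmatched-case : ∀ {x} → Unmatched M x →
        2 * ⟦ U x ⟧ + (⟦ R x ⟧ + (⟦ a x ⟧ + ⟦ b x ⟧ + (⟦ a (m x) ⟧ + ⟦ b (m x) ⟧))) ≤ 2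
      unmatched-case {x} ux rewrite unmatched-∈ M ux | blind-u ux | blind-v ux
                                  | blind-u (cong m ux) | blind-v (cong m ux) = ≤-refl
      four : ∀ a₁ b₁ a₂ b₂ → (a₁ ∧ b₂ ∨ b₁ ∧ a₂) ≡ false →
        ⟦ irregular a₁ b₁ a₂ b₂ ⟧ + (⟦ a₁ ⟧ + ⟦ b₁ ⟧ + (⟦ a₂ ⟧ + ⟦ b₂ ⟧)) ≤ 2
      four = ≤-by-truth-table 4 _
      matched-case : ∀ {x} → Matched M x →
        2 * ⟦ U x ⟧ + (⟦ R x ⟧ + (⟦ a x ⟧ + ⟦ b x ⟧ + (⟦ a (m x) ⟧ + ⟦ b (m x) ⟧))) ≤ 2
      matched-case {x} mx rewrite matched-∉ M mx = four (a x) (b x) (a (m x)) (b (m x)) (uncrossed x)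

    r rc : ℕ
    r  = countF U
    rc = countF R

    few-irregular : rc + 2 * r ≤ 2 * d
    few-irregular = irregular-bound r rc (degree G u) (degree G v) n d summed (min-degree u) (min-degree v)
      where
      open ≤-Reasoning
      w : Fin n → ℕ
      w x = ⟦ a x ⟧ + ⟦ b x ⟧
      Σw : sumF w ≡ degree G u + degree G v
      Σw = trans (sum-+ (λ x → ⟦ a x ⟧) (λ x → ⟦ b x ⟧)) (sym (cong₂ _+_ (count-as-sum a) (count-as-sum b)))
      summed : 2 * r + (rc + 2 * (degree G u + degree G v)) ≤ 2 * n
      summed = begin
        2 * r + (rc + 2 * (degree G u + degree G v))
          ≡⟨ cong₂ (λ k l → 2 * k + (l + 2 * (degree G u + degree G v))) (count-as-sum U) (count-as-sum R) ⟩
        2 * sumF (λ x → ⟦ U x ⟧) + (sumF (λ x → ⟦ R x ⟧) + 2 * (degree G u + degree G v))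
          ≡⟨ cong (λ k → 2 * sumF (λ x → ⟦ U x ⟧) + (sumF (λ x → ⟦ R x ⟧) + k))
               (trans (cong (λ k → k + (k + 0)) (sym Σw))
                      (cong (λ k → sumF w + (k + 0)) (sym (sum-involution m (mate-involutive M) w)))) ⟩
        2 * sumF (λ x → ⟦ U x ⟧) + (sumF (λ x → ⟦ R x ⟧) + (sumF w + (sumF (w ∘ m) + 0)))
          ≡⟨ cong (λ k → 2 * sumF (λ x → ⟦ U x ⟧) + (sumF (λ x → ⟦ R x ⟧) + (sumF w + k))) (+-identityʳ _) ⟩
        2 * sumF (λ x → ⟦ U x ⟧) + (sumF (λ x → ⟦ R x ⟧) + (sumF w + sumF (w ∘ m)))
          ≡⟨ sym (trans (sum-+ (λ x → 2 * ⟦ U x ⟧) (λ x → ⟦ R x ⟧ + (w x + w (m x))))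
                   (cong₂ _+_ (sum-*ˡ 2 (λ x → ⟦ U x ⟧))
                              (trans (sum-+ (λ x → ⟦ R x ⟧) (λ x → w x + w (m x)))
                                     (cong (sumF (λ x → ⟦ R x ⟧) +_) (sum-+ w (w ∘ m)))))) ⟩
        sumF (λ x → 2 * ⟦ U x ⟧ + (⟦ R x ⟧ + (w x + w (m x))))
          ≤⟨ sum-mono local-count ⟩
        sumF {n} (λ _ → 2)
          ≡⟨ trans (sum-const {n} 2) (*-comm n 2) ⟩
        2 * n ∎

    count-bound : ∀ (C D : VSet n) → (∀ x → ⟦ C x ⟧ ≤ ⟦ D x ⟧ + ⟦ R x ⟧) → countF C ≤ countF D + rc
    count-bound C D le = begin
      countF C                                  ≡⟨ count-as-sum C ⟩
      sumF (λ x → ⟦ C x ⟧)                      ≤⟨ sum-mono le ⟩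
      sumF (λ x → ⟦ D x ⟧ + ⟦ R x ⟧)            ≡⟨ sum-+ (λ x → ⟦ D x ⟧) (λ x → ⟦ R x ⟧) ⟩
      sumF (λ x → ⟦ D x ⟧) + sumF (λ x → ⟦ R x ⟧) ≡⟨ sym (cong₂ _+_ (count-as-sum D) (count-as-sum R)) ⟩
      countF D + rc                             ∎
      where open ≤-Reasoning

    -- Case 1: the partner of some vertex y sees both u and v.  Then the vertices
    -- whose partners see both, together with the unmatched ones, form an
    -- independent set of size ≥ |X|, while y has at most |X| + |R| neighbours.
    module PartnerSeesBoth {y : Fin n} (Yy : Y y ≡ true) where

      Y-blind-u : ∀ {s} → Y s ≡ true → a s ≡ false
      Y-blind-u {s} Ys = ¬-not λ as → true≢false (∧-true₂ Ys) (crossing-u as)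

      -- No edges from such a vertex to an unmatched one (paths u s' s t, or s' seeing u).
      Y-unmatched-apart : ∀ {s t} → Y s ≡ true → Unmatched M t → Adjacent s t → ⊥
      Y-unmatched-apart {s} {t} Ys ut st with t ≟ u
      ... | yes refl = true≢false (adjacent-sym st) (Y-blind-u Ys)
      ... | no t≢u   = true≢false st (trans (Graph.sym G s t)
                         (subst (λ k → adj G t k ≡ false) (mate-involutive M s)
                                (no-path₃ u-unmatched ut (t≢u ∘ sym) (∧-true₁ Ys))))

      -- No edges among such vertices (a path u s' s t t' v, or s' = t seeing u).
      Y-apart : ∀ {s t} → Y s ≡ true → Y t ≡ true → Adjacent s t → ⊥
      Y-apart {s} {t} Ys Yt st with t ≟ m s
      ... | yes refl = true≢false (∧-true₁ (subst (λ k → X k ≡ true) (mate-involutive M s) Yt)) (Y-blind-u Ys)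
      ... | no t≢s'  = true≢false (∧-true₂ Yt) (long-u t≢s' (∧-true₁ Ys) st)

      I : VSet n
      I = U ∪ Y

      independent : NoEdges I I
      independent = no-edges λ {s} {t} Is It st → case ∨-true {U s} Is , ∨-true {U t} It of λ where
        (inj₁ Us , inj₁ Ut) → true≢false st (no-path₁ (∈-unmatched M Us) (∈-unmatched M Ut))
        (inj₁ Us , inj₂ Yt) → Y-unmatched-apart Yt (∈-unmatched M Us) (adjacent-sym st)
        (inj₂ Ys , inj₁ Ut) → Y-unmatched-apart Ys (∈-unmatched M Ut) st
        (inj₂ Ys , inj₂ Yt) → Y-apart Ys Yt st

      -- |Y| = |X| since Y is X composed with the matching involution.
      |X|≤|I| : countF X ≤ countF I
      |X|≤|I| = begin
        countF X                   ≡⟨ count-as-sum X ⟩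
        sumF (λ x → ⟦ X x ⟧)       ≡⟨ sym (sum-involution m (mate-involutive M) (λ x → ⟦ X x ⟧)) ⟩
        sumF (λ x → ⟦ Y x ⟧)       ≡⟨ sym (count-as-sum Y) ⟩
        countF Y                   ≤⟨ count-mono {B = I} (λ x Yx → trans (cong (U x ∨_) Yx) (∨-zeroʳ (U x))) ⟩
        countF I                   ∎
        where open ≤-Reasoning

      neighbour : ∀ {z} → Adjacent y z → X z ≡ true ⊎ R z ≡ true
      neighbour {z} yz with X z Bool.≟ true
      ... | yes Xz = inj₁ Xz
      ... | no ¬Xz = inj₂ (trans (cong (λ k → not k ∧ irregular (a z) (b z) (a (m z)) (b (m z))) (matched-∉ M mz))
                                 (indicator-positive (irregular-edge (a z) (b z) (a (m z)) (b (m z))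
                                                        (∨-false (¬-not ¬Xz) (∨-false a₂ b₂)))))
        where
        irregular-edge : ∀ a₁ b₁ a₂ b₂ → (a₁ ∧ b₁ ∨ a₂ ∨ b₂) ≡ false → 1 ≤ ⟦ irregular a₁ b₁ a₂ b₂ ⟧
        irregular-edge = ≤-by-truth-table 4 _
        mz : Matched M z
        mz uz = Y-unmatched-apart Yy uz yz
        y≢z' : y ≢ m z
        y≢z' refl = ¬Xz (subst (λ k → X k ≡ true) (mate-involutive M z) Yy)
        a₂ : a (m z) ≡ false
        a₂ = ¬-not λ e → true≢false (∧-true₂ Yy) (long-u y≢z' e (adjacent-sym yz))
        b₂ : b (m z) ≡ false
        b₂ = ¬-not λ e → true≢false (∧-true₁ Yy) (long-v y≢z' e (adjacent-sym yz))

      degree-y : degree G y ≤ countF X + rc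
      degree-y = count-bound (adj G y) X (λ z → indicator-⊎ {adj G y z} {X z} {R z} neighbour)

      extremal : Extremal h (n * (5 * d))
      extremal with extend-independent n≡h+h I independent
      ... | T , h≤|T| , edges≤ = sparse-set T h≤|T| (error-bound {h = h} d n≡h+h edges≤
              (≤-trans (deficit {h = h} d n≡h+h (min-degree y) degree-y |X|≤|I|) (slack₁ {rc} {r} d few-irregular)))

    -- Case 2: no partner sees both u and v (so no vertex does either).  Every
    -- matched vertex lies in exactly one of P, Q, R; there are no edges between
    -- P and Q, and u, v have their neighbours essentially in P, Q respectively.
    module NoPartnerSeesBoth (noY : ∀ y → Y y ≡ false) where

      noX : ∀ x → X x ≡ false
      noX x = trans (cong X (sym (mate-involutive M x))) (noY (m x))

      excluded : ∀ x → ((a x ∧ b (m x) ∨ b x ∧ a (m x)) ∨ (a x ∧ b x ∨ a (m x) ∧ b (m x))) ≡ false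
      excluded x = ∨-false (uncrossed x) (∨-false (noX x) (noY x))

      disjoint : Disjoint P Q
      disjoint x with a x | b x | noX x
      ... | false | _     | _  = refl
      ... | true  | false | _  = ∧-zeroʳ (a (m x))
      ... | true  | true  | ()

      P-Q-apart : ∀ {s t} → P s ≡ true → Q t ≡ true → Adjacent s t → ⊥
      P-Q-apart {s} {t} Ps Qt st with t ≟ m s
      ... | yes refl = true≢false (∧-intro (∧-true₁ Ps) bs) (noX s)
        where bs = subst (λ k → b k ≡ true) (mate-involutive M s) (∧-true₂ Qt)
      ... | no t≢s'  = true≢false (∧-true₂ Qt) (long-u t≢s' (∧-true₂ Ps) st)

      sees-u : ∀ x → ⟦ a x ⟧ ≤ ⟦ P x ⟧ + ⟦ R x ⟧
      sees-u = by-cases _ unmatched-case matched-case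
        where
        unmatched-case : ∀ {x} → Unmatched M x → ⟦ a x ⟧ ≤ ⟦ P x ⟧ + ⟦ R x ⟧
        unmatched-case ux rewrite blind-u ux = z≤n
        local : ∀ a₁ b₁ a₂ b₂ → ((a₁ ∧ b₂ ∨ b₁ ∧ a₂) ∨ (a₁ ∧ b₁ ∨ a₂ ∧ b₂)) ≡ false →
          ⟦ a₁ ⟧ ≤ ⟦ a₁ ∧ a₂ ⟧ + ⟦ irregular a₁ b₁ a₂ b₂ ⟧
        local = ≤-by-truth-table 4 _
        matched-case : ∀ {x} → Matched M x → ⟦ a x ⟧ ≤ ⟦ P x ⟧ + ⟦ R x ⟧
        matched-case {x} mx rewrite matched-∉ M mx = local (a x) (b x) (a (m x)) (b (m x)) (excluded x)

      sees-v : ∀ x → ⟦ b x ⟧ ≤ ⟦ Q x ⟧ + ⟦ R x ⟧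
      sees-v = by-cases _ unmatched-case matched-case
        where
        unmatched-case : ∀ {x} → Unmatched M x → ⟦ b x ⟧ ≤ ⟦ Q x ⟧ + ⟦ R x ⟧
        unmatched-case ux rewrite blind-v ux = z≤n
        local : ∀ a₁ b₁ a₂ b₂ → ((a₁ ∧ b₂ ∨ b₁ ∧ a₂) ∨ (a₁ ∧ b₁ ∨ a₂ ∧ b₂)) ≡ false →
          ⟦ b₁ ⟧ ≤ ⟦ b₁ ∧ b₂ ⟧ + ⟦ irregular a₁ b₁ a₂ b₂ ⟧
        local = ≤-by-truth-table 4 _
        matched-case : ∀ {x} → Matched M x → ⟦ b x ⟧ ≤ ⟦ Q x ⟧ + ⟦ R x ⟧
        matched-case {x} mx rewrite matched-∉ M mx = local (a x) (b x) (a (m x)) (b (m x)) (excluded x)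

      rest : ∀ x → ⟦ not (P x) ∧ not (Q x) ⟧ ≡ ⟦ R x ⟧ + ⟦ U x ⟧
      rest = by-cases _ unmatched-case matched-case
        where
        unmatched-case : ∀ {x} → Unmatched M x → ⟦ not (P x) ∧ not (Q x) ⟧ ≡ ⟦ R x ⟧ + ⟦ U x ⟧
        unmatched-case {x} ux rewrite unmatched-∈ M ux | blind-u ux | blind-v ux = refl
        local : ∀ a₁ b₁ a₂ b₂ → ((a₁ ∧ b₂ ∨ b₁ ∧ a₂) ∨ (a₁ ∧ b₁ ∨ a₂ ∧ b₂)) ≡ false →
          ⟦ not (a₁ ∧ a₂) ∧ not (b₁ ∧ b₂) ⟧ ≡ ⟦ irregular a₁ b₁ a₂ b₂ ⟧ + 0
        local = ≡-by-truth-table 4 _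
        matched-case : ∀ {x} → Matched M x → ⟦ not (P x) ∧ not (Q x) ⟧ ≡ ⟦ R x ⟧ + ⟦ U x ⟧
        matched-case {x} mx rewrite matched-∉ M mx = local (a x) (b x) (a (m x)) (b (m x)) (excluded x)

      |rest| : countF (∁ P ∩ ∁ Q) ≡ rc + r
      |rest| = begin
        countF (∁ P ∩ ∁ Q)                           ≡⟨ count-as-sum (∁ P ∩ ∁ Q) ⟩
        sumF (λ x → ⟦ not (P x) ∧ not (Q x) ⟧)       ≡⟨ sum-cong rest ⟩
        sumF (λ x → ⟦ R x ⟧ + ⟦ U x ⟧)               ≡⟨ sum-+ (λ x → ⟦ R x ⟧) (λ x → ⟦ U x ⟧) ⟩
        sumF (λ x → ⟦ R x ⟧) + sumF (λ x → ⟦ U x ⟧)  ≡⟨ sym (cong₂ _+_ (count-as-sum R) (count-as-sum U)) ⟩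
        rc + r                                       ∎
        where open ≡-Reasoning

      half-inside : ∀ {S T : VSet n} w → Disjoint S T → NoEdges S T → h ≤ countF S →
        degree G w ≤ countF T + rc → Extremal h (n * (5 * d))
      half-inside {S} {T} w disjoint′ no-edges′ h≤|S| degree-w =
        sparse-cut A |A|≡h (error-bound {h = h} d n≡h+h cross≤
          (≤-trans (deficit {h = h} {x = countF T} {c = rc} d n≡h+h (min-degree w) degree-w ≤-refl)
                   (slack₁ {rc} {r} d few-irregular)))
        where
        cut : Σ (VSet n) λ A → countF A ≡ h × crossF A ≤ h * (h ∸ countF T)
        cut = cut-inside n≡h+h S T disjoint′ no-edges′ h≤|S|
        A : VSet n
        A = proj₁ cut
        |A|≡h : countF A ≡ h
        |A|≡h = proj₁ (proj₂ cut)
        cross≤ : crossF A ≤ h * (h ∸ countF T)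
        cross≤ = proj₂ (proj₂ cut)

      completed : countF P ≤ h → countF Q ≤ h → Extremal h (n * (5 * d))
      completed |P|≤h |Q|≤h = sparse-cut A |A|≡h (error-bound {h = h} d n≡h+h
          (subst (λ k → crossF A ≤ h * k) |rest| cross≤) (slack₂ {rc} {r} d few-irregular))
        where
        cut : Σ (VSet n) λ A → countF A ≡ h × crossF A ≤ h * countF (∁ P ∩ ∁ Q)
        cut = cut-between n≡h+h P Q disjoint (no-edges P-Q-apart) |P|≤h |Q|≤h
        A : VSet n
        A = proj₁ cut
        |A|≡h : countF A ≡ h
        |A|≡h = proj₁ (proj₂ cut)
        cross≤ : crossF A ≤ h * countF (∁ P ∩ ∁ Q)
        cross≤ = proj₂ (proj₂ cut)

      extremal : Extremal h (n * (5 * d))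
      extremal with h ≤? countF P | h ≤? countF Q
      ... | yes h≤|P| | _         = half-inside v disjoint (no-edges P-Q-apart) h≤|P| (count-bound b Q sees-v)
      ... | no _      | yes h≤|Q| = half-inside u (λ x → trans (∧-comm (Q x) (P x)) (disjoint x))
                                      (no-edges λ Qs Pt st → P-Q-apart Pt Qs (adjacent-sym st)) h≤|Q|
                                      (count-bound a P sees-u)
      ... | no h≰|P|  | no h≰|Q|  = completed (<⇒≤ (≰⇒> h≰|P|)) (<⇒≤ (≰⇒> h≰|Q|))

    extremal : Extremal h (n * (5 * d))
    extremal with search Y
    ... | inj₁ (y , Yy) = PartnerSeesBoth.extremal Yy
    ... | inj₂ noY      = NoPartnerSeesBoth.extremal noY

  maxF : ∀ {n} → (Fin n → ℕ) → ℕ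
  maxF {zero}  f = 0
  maxF {suc n} f = f zero ⊔ maxF (f ∘ suc)

  ≤-maxF : ∀ {n} (f : Fin n → ℕ) x → f x ≤ maxF f
  ≤-maxF f zero    = m≤m⊔n (f zero) _
  ≤-maxF f (suc x) = ≤-trans (≤-maxF (f ∘ suc) x) (m≤n⊔m (f zero) _)

  maxF-attained : ∀ {n} (f : Fin n → ℕ) → maxF f ≡ 0 ⊎ Σ (Fin n) λ x → maxF f ≡ f x
  maxF-attained {zero}  f = inj₁ refl
  maxF-attained {suc n} f with ⊔-sel (f zero) (maxF (f ∘ suc)) | maxF-attained (f ∘ suc)
  ... | inj₁ e | _              = inj₂ (zero , e)
  ... | inj₂ e | inj₁ e₀        = inj₁ (trans e e₀)
  ... | inj₂ e | inj₂ (x , e₁)  = inj₂ (suc x , trans e e₁)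

  module Rationals where

    open import Data.Rational using (mkℚ) renaming (_+_ to _+ℚ_)
    import Data.Rational.Properties as ℚP
    open import Data.Rational.Solver using (module +-*-Solver)
    import Data.Integer as ℤ
    import Data.Integer.Properties as ℤ
    import Data.Nat.Coprimality as Coprimality

    private
      as-mkℚ : ∀ k → ℕ→ℚ k ≡ mkℚ (ℤ.+ k) 0 (Coprimality.sym (Coprimality.1-coprimeTo k))
      as-mkℚ k = ℚP.normalize-coprime (Coprimality.sym (Coprimality.1-coprimeTo k))

    ℕ→ℚ-+ : ∀ j k → ℕ→ℚ (j + k) ≡ ℕ→ℚ j +ℚ ℕ→ℚ k
    ℕ→ℚ-+ j k rewrite as-mkℚ j | as-mkℚ k =
      cong (λ z → z ℚ./ 1) (sym (trans (cong₂ ℤ._+_ (ℤ.*-identityʳ (ℤ.+ j)) (ℤ.*-identityʳ (ℤ.+ k)))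
                                       (sym (ℤ.pos-+ j k))))

    ℕ→ℚ-* : ∀ j k → ℕ→ℚ (j * k) ≡ ℕ→ℚ j *ℚ ℕ→ℚ k
    ℕ→ℚ-* j k rewrite as-mkℚ j | as-mkℚ k = cong (λ z → z ℚ./ 1) (ℤ.pos-* j k)

    ℕ→ℚ-mono : ∀ {j k} → j ≤ k → ℕ→ℚ j ≤ℚ ℕ→ℚ k
    ℕ→ℚ-mono {j} {k} j≤k rewrite as-mkℚ j | as-mkℚ k =
      ℚ.*≤* (subst₂ ℤ._≤_ (sym (ℤ.*-identityʳ (ℤ.+ j))) (sym (ℤ.*-identityʳ (ℤ.+ k))) (ℤ.+≤+ j≤k))

    ℕ→ℚ-nonneg : ∀ k → 0ℚ ≤ℚ ℕ→ℚ k
    ℕ→ℚ-nonneg k = ℕ→ℚ-mono {0} {k} z≤n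

    *-monoˡ-≤ℚ : ∀ r {p q} → 0ℚ ≤ℚ r → p ≤ℚ q → r *ℚ p ≤ℚ r *ℚ q
    *-monoˡ-≤ℚ r 0≤r = ℚP.*-monoˡ-≤-nonNeg r {{ℚ.nonNegative 0≤r}}

    *-nonneg : ∀ {p q} → 0ℚ ≤ℚ p → 0ℚ ≤ℚ q → 0ℚ ≤ℚ p *ℚ q
    *-nonneg {p} {q} 0≤p 0≤q = subst (_≤ℚ p *ℚ q) (ℚP.*-zeroʳ p) (*-monoˡ-≤ℚ p 0≤p 0≤q)

    open +-*-Solver

    module _ (γ : ℚ) (γ>0 : 0ℚ <ℚ γ) where

      private
        0≤γ : 0ℚ ≤ℚ γ
        0≤γ = ℚP.<⇒≤ γ>0
        two : ℚ
        two = ℕ→ℚ 2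

      2γn-nonneg : ∀ n → 0ℚ ≤ℚ two *ℚ γ *ℚ ℕ→ℚ n
      2γn-nonneg n = *-nonneg (*-nonneg (ℕ→ℚ-nonneg 2) 0≤γ) (ℕ→ℚ-nonneg n)

      deficiency-bound : ∀ n deg → (½ -ℚ γ) *ℚ ℕ→ℚ n ≤ℚ ℕ→ℚ deg → ℕ→ℚ (n ∸ (deg + deg)) ≤ℚ two *ℚ γ *ℚ ℕ→ℚ n
      deficiency-bound n deg δ with ≤-total (deg + deg) n
      ... | inj₂ n≤2deg = subst (_≤ℚ two *ℚ γ *ℚ ℕ→ℚ n) (cong ℕ→ℚ (sym (m≤n⇒m∸n≡0 n≤2deg))) (2γn-nonneg n)
      ... | inj₁ 2deg≤n = begin
        X                                                       ≡⟨ solve 3 (λ x nn g → x := (x :+ con two :* (con ½ :- g) :* nn) :+ (con two :* g :* nn :- nn)) refl X N γ ⟩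
        (X +ℚ two *ℚ (½ -ℚ γ) *ℚ N) +ℚ (two *ℚ γ *ℚ N -ℚ N)    ≤⟨ ℚP.+-monoˡ-≤ (two *ℚ γ *ℚ N -ℚ N) X+2δ≤N ⟩
        N +ℚ (two *ℚ γ *ℚ N -ℚ N)                               ≡⟨ solve 2 (λ nn g → nn :+ (con two :* g :* nn :- nn) := con two :* g :* nn) refl N γ ⟩
        two *ℚ γ *ℚ N                                           ∎
        where
        open ℚP.≤-Reasoning
        N X D : ℚ
        N = ℕ→ℚ n
        X = ℕ→ℚ (n ∸ (deg + deg))
        D = ℕ→ℚ deg
        X+2δ≤N : X +ℚ two *ℚ (½ -ℚ γ) *ℚ N ≤ℚ N
        X+2δ≤N = begin
          X +ℚ two *ℚ (½ -ℚ γ) *ℚ N     ≡⟨ cong (X +ℚ_) (ℚP.*-assoc two (½ -ℚ γ) N) ⟩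
          X +ℚ two *ℚ ((½ -ℚ γ) *ℚ N)   ≤⟨ ℚP.+-monoʳ-≤ X (*-monoˡ-≤ℚ two (ℕ→ℚ-nonneg 2) δ) ⟩
          X +ℚ two *ℚ D                 ≡⟨ cong (X +ℚ_) (sym (ℕ→ℚ-* 2 deg)) ⟩
          X +ℚ ℕ→ℚ (2 * deg)            ≡⟨ sym (ℕ→ℚ-+ (n ∸ (deg + deg)) (2 * deg)) ⟩
          ℕ→ℚ (n ∸ (deg + deg) + 2 * deg) ≡⟨ cong ℕ→ℚ (trans (cong (n ∸ (deg + deg) +_) (cong (deg +_) (+-identityʳ deg))) (m∸n+n≡m 2deg≤n)) ⟩
          N                             ∎

      error-bound-ℚ : ∀ {E n d} → 4 * E ≤ n * (5 * d) → ℕ→ℚ d ≤ℚ two *ℚ γ *ℚ ℕ→ℚ n →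
        ℕ→ℚ E ≤ℚ ℕ→ℚ 3 *ℚ γ *ℚ ℕ→ℚ (n * n)
      error-bound-ℚ {E} {n} {d} 4E≤5nd d≤2γn = ℚP.*-cancelˡ-≤-pos (ℕ→ℚ 4) (begin
        ℕ→ℚ 4 *ℚ ℕ→ℚ E                                  ≡⟨ sym (ℕ→ℚ-* 4 E) ⟩
        ℕ→ℚ (4 * E)                                     ≤⟨ ℕ→ℚ-mono 4E≤5nd ⟩
        ℕ→ℚ (n * (5 * d))                               ≡⟨ trans (ℕ→ℚ-* n (5 * d)) (cong (N *ℚ_) (ℕ→ℚ-* 5 d)) ⟩
        N *ℚ (ℕ→ℚ 5 *ℚ ℕ→ℚ d)                           ≤⟨ *-monoˡ-≤ℚ N (ℕ→ℚ-nonneg n) (*-monoˡ-≤ℚ (ℕ→ℚ 5) (ℕ→ℚ-nonneg 5) d≤2γn) ⟩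
        N *ℚ (ℕ→ℚ 5 *ℚ (two *ℚ γ *ℚ N))                 ≤⟨ ℚP.≤-trans (ℚP.≤-reflexive (sym (ℚP.+-identityʳ _)))
                                                             (ℚP.+-monoʳ-≤ (N *ℚ (ℕ→ℚ 5 *ℚ (two *ℚ γ *ℚ N))) (*-nonneg (*-nonneg (ℕ→ℚ-nonneg 2) 0≤γ) (*-nonneg (ℕ→ℚ-nonneg n) (ℕ→ℚ-nonneg n)))) ⟩
        N *ℚ (ℕ→ℚ 5 *ℚ (two *ℚ γ *ℚ N)) +ℚ two *ℚ γ *ℚ (N *ℚ N)
          ≡⟨ solve 2 (λ g x → x :* (con (ℕ→ℚ 5) :* (con two :* g :* x)) :+ con two :* g :* (x :* x)
                              := con (ℕ→ℚ 4) :* (con (ℕ→ℚ 3) :* g :* (x :* x))) refl γ N ⟩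
        ℕ→ℚ 4 *ℚ (ℕ→ℚ 3 *ℚ γ *ℚ (N *ℚ N))               ≡⟨ cong (λ k → ℕ→ℚ 4 *ℚ (ℕ→ℚ 3 *ℚ γ *ℚ k)) (sym (ℕ→ℚ-* n n)) ⟩
        ℕ→ℚ 4 *ℚ (ℕ→ℚ 3 *ℚ γ *ℚ ℕ→ℚ (n * n))            ∎)
        where
        open ℚP.≤-Reasoning
        N : ℚ
        N = ℕ→ℚ n

  card-tabulate : ∀ {n} (A : VSet n) → ∣ tabulate A ∣ ≡ countF A
  card-tabulate {zero}  A = refl
  card-tabulate {suc n} A with A zero
  ... | true  = cong suc (card-tabulate (A ∘ suc))
  ... | false = card-tabulate (A ∘ suc)

  module _ {n : ℕ} (G : Graph n) where
    open SparseSets G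

    edges-tabulate : ∀ S → edgesIn G (tabulate S) ≡ edgesF S
    edges-tabulate S = sum-cong λ s → count-cong λ t →
      cong₂ (λ p q → p ∧ q ∧ adj G s t ∧ (toℕ s <ᵇ toℕ t)) (lookup∘tabulate S s) (lookup∘tabulate S t)

    cross-tabulate : ∀ A → crossEdges G (tabulate A) ≡ crossF A
    cross-tabulate A = sum-cong λ s → count-cong λ t →
      cong₂ (λ p q → p ∧ not q ∧ adj G s t) (lookup∘tabulate A s) (lookup∘tabulate A t)

  Outcome : ℚ → ∀ {n} → Graph n → Set
  Outcome γ {n} G = (Σ (Subset n) λ S → (n / 2 ≤ ∣ S ∣) × Independent G (ℕ→ℚ 3 *ℚ γ) S)
                  ⊎ CloseTo2K G (ℕ→ℚ 3 *ℚ γ)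
                  ⊎ PerfectMatching G

  module Conclusion (γ : ℚ) (γ>0 : 0ℚ <ℚ γ) {n h : ℕ} (n≡h+h : n ≡ h + h) (G : Graph n)
    (δ : MinDegreeAtLeast G ((½ -ℚ γ) *ℚ ℕ→ℚ n)) where

    open Rationals
    open SparseSets G

    deficiency : Fin n → ℕ
    deficiency x = n ∸ (degree G x + degree G x)

    d : ℕ
    d = maxF deficiency

    min-degree : ∀ x → n ≤ degree G x + degree G x + d
    min-degree x = ≤-trans (m≤n+m∸n n (degree G x + degree G x))
                           (+-monoʳ-≤ (degree G x + degree G x) (≤-maxF deficiency x))

    d≤2γn : ℕ→ℚ d ≤ℚ ℕ→ℚ 2 *ℚ γ *ℚ ℕ→ℚ n
    d≤2γn with maxF-attained deficiency
    ... | inj₁ d≡0       rewrite d≡0 = 2γn-nonneg γ γ>0 n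
    ... | inj₂ (x , d≡x) rewrite d≡x = deficiency-bound γ γ>0 n (degree G x) (δ x)

    n/2≡h : n / 2 ≡ h
    n/2≡h = trans (cong (_/ 2) (trans n≡h+h (sym (twice h)))) (m*n/n≡m h 2)

    from-extremal : Extremal h (n * (5 * d)) → Outcome γ G
    from-extremal (sparse-set S h≤|S| bound) =
      inj₁ (tabulate S , subst₂ _≤_ (sym n/2≡h) (sym (card-tabulate S)) h≤|S| ,
            subst (λ E → ℕ→ℚ E ≤ℚ ℕ→ℚ 3 *ℚ γ *ℚ ℕ→ℚ (n * n)) (sym (edges-tabulate G S))
                  (error-bound-ℚ γ γ>0 {edgesF S} {n} {d} bound d≤2γn))
    from-extremal (sparse-cut A |A|≡h bound) =
      inj₂ (inj₁ (tabulate A , trans (card-tabulate A) (trans |A|≡h (sym n/2≡h)) ,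
            subst (λ E → ℕ→ℚ E ≤ℚ ℕ→ℚ 3 *ℚ γ *ℚ ℕ→ℚ (n * n)) (sym (cross-tabulate G A))
                  (error-bound-ℚ γ γ>0 {crossF A} {n} {d} bound d≤2γn)))

    outcome : Outcome γ G
    outcome with Matchings.perfect-or-stuck G {h} n≡h+h
    ... | inj₁ perfect = inj₂ (inj₂ perfect)
    ... | inj₂ stuck   = from-extremal (Structure.extremal G {h} d n≡h+h min-degree stuck)

  proposition-for-even-order : ∀ γ → 0ℚ <ℚ γ → ∀ {n} → 2 ∣ n → (G : Graph n) →
    MinDegreeAtLeast G ((½ -ℚ γ) *ℚ ℕ→ℚ n) → Outcome γ G
  proposition-for-even-order γ γ>0 (divides h n≡h*2) =
    Conclusion.outcome γ γ>0 {h = h} (trans n≡h*2 (twice h))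

open import Defs
open import Data.Nat using (ℕ; _≥_; _/_)
open import Data.Nat.Divisibility using (_∣_)
open import Data.Fin.Subset using (Subset; ∣_∣)
open import Data.Rational using (ℚ; _<_; _*_; _-_; ½; 0ℚ; 1ℚ)
open import Data.Product using (Σ; _×_; _,_)
open import Data.Sum using (_⊎_)

proposition10p5 : (γ : ℚ) → 0ℚ < γ →
    Σ ℕ λ n₀ → (n : ℕ) → n ≥ n₀ → 2 ∣ n →
    (G : Graph n) → MinDegreeAtLeast G ((½ - γ) * ℕ→ℚ n) →
    (Σ (Subset n) λ S → (∣ S ∣ ≥ n / 2) × Independent G (ℕ→ℚ 3 * γ) S)
    ⊎ CloseTo2K G (ℕ→ℚ 3 * γ)
    ⊎ PerfectMatching G
proposition10p5 γ γ>0 = 0 , λ n _ → proposition-for-even-order γ γ>0
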